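{- In the monotonicity construction described in the context, every function in the support of $\mathcal D_{\mathrm{yes}}$ is $(0.1c_1\varepsilon)$-close to monotone, i.e. there is a monotone $g:\{0,1\}^n\to\{0,1\}$ with $\Pr_{x\sim\{0,1\}^n}[f(x)\ne g(x)]\le 0.1c_1\varepsilon$.
   Context: Let $c_0$ be a sufficiently large absolute constant and $c_1>0$ a sufficiently small absolute constant. Let $\varepsilon\in(0,1)$ with $\varepsilon\ge c_0/\sqrt n$, $a=\sqrt n/\varepsilon$, $m=n-a$. For $y\in\{0,1\}^a$ (coordinates indexed by a set $A$ of size $a$) define: $h^{(+,0)}(y)=0$ always; $h^{(+,1)}(y)=1$ iff $|y|>a/2+c_1\sqrt a$ or $|y|<a/2-c_1\sqrt a$; $h^{(-,0)}(y)=1$ iff $|y|>a/2+c_1\sqrt a$; $h^{(-,1)}(y)=1$ iff $|y|<a/2-c_1\sqrt a$ (here $|y|$ is Hamming weight). For a set $C$ of size $m$, let $L=0.1\cdot 2^{\sqrt m/\varepsilon}$ and let $\mathbf T=(\mathbf T_1,\dots,\mathbf T_L)$ be drawn from $\mathsf{Talagrand}(m,\varepsilon)$ on $C$: independently, each $\mathbf T_i\subseteq C$ is the set of $\sqrt m/\varepsilon$ elements of $C$ drawn independently and uniformly with replacement; $T_i(z)=1$ iff $z_j=1$ for all $j\in T_i$, and $S_T(z)=\{\ell\in[L]:T_\ell(z)=1\}$ for $z\in\{0,1\}^C$. For $x\in\{0,1\}^n$ and $B\subseteq[n]$, $x_B$ is the restriction of $x$ to coordinates in $B$. A draw $\mathbf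 f_{\mathrm{yes}}\sim\mathcal D_{\mathrm{yes}}$: pick $\mathbf A\subseteq[n]$ uniformly among sets of size $a$, set $\mathbf C=[n]\setminus\mathbf A$, draw $\mathbf T\sim\mathsf{Talagrand}(m,\varepsilon)$ on $\mathbf C$, and $\mathbf b\in\{0,1\}^L$ uniform; then, applying the first case that holds, $\mathbf f_{\mathrm{yes}}(x)=1$ if $|S_{\mathbf T}(x_{\mathbf C})|>1$ or $|x_{\mathbf C}|>m/2+0.05\varepsilon\sqrt m$; $\mathbf f_{\mathrm{yes}}(x)=0$ if $|S_{\mathbf T}(x_{\mathbf C})|=0$ or $|x_{\mathbf C}|<m/2$; otherwise $S_{\mathbf T}(x_{\mathbf C})=\{\ell\}$ and $|x_{\mathbf C}|\in[m/2,m/2+0.05\varepsilon\sqrt m]$, and $\mathbf f_{\mathrm{yes}}(x)=h^{(+,\mathbf b_\ell)}(x_{\mathbf A})$. A draw $\mathbf f_{\mathrm{no}}\sim\mathcal D_{\mathrm{no}}$ is defined identically except that $h^{(+,\mathbf b_\ell)}$ is replaced by $h^{(-,\mathbf b_\ell)}$. A function is monotone if $x\le y$ coordinatewise implies $f(x)\le f(y)$.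
   Formalization: The parameter ε ∈ (0,1) and the small constant c₁ take only rational values. -}

module Defs where

open import Data.Bool using (Bool; true; false; not; _∧_; _∨_; if_then_else_)
open import Data.Nat as ℕ using (ℕ; zero; suc; _∸_)
open import Data.Integer as ℤ using (ℤ; +_)
open import Data.Rational as ℚ using (ℚ; _≤ᵇ_; _/_; _*_; _+_; _-_; _≤_; _<_)
open import Data.Fin using (Fin)
open import Data.Bool.ListAction using (and)
open import Data.Fin.Subset using (Subset; ∁; _∩_; ∣_∣)
open import Data.Vec using (Vec; []; _∷_; lookup)
open import Data.List as List using (List; []; _∷_; filterᵇ; allFin; length)
open import Data.Product using (Σ; _×_; _,_)
open import Relation.Binary.PropositionalEquality using (_≡_)

ℕ→ℚ : ℕ → ℚ
ℕ→ℚ n = + n / 1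

_<ᵇ_ : ℚ → ℚ → Bool
p <ᵇ q = not (q ≤ᵇ p)

-- Real-valued thresholds with square roots, decided exactly:
-- above w a t  :  w > a/2 + t * sqrt a      (for t ≥ 0)
--   i.e. d = 2w - a satisfies d > 0 and d^2 > 4 t^2 a
above : ℕ → ℕ → ℚ → Bool
above w a t = (0ℚ' <ᵇ d) ∧ ((ℕ→ℚ 4 * t * t * ℕ→ℚ a) <ᵇ (d * d))
  where
  0ℚ' = ℕ→ℚ 0
  d = ℕ→ℚ (2 ℕ.* w) - ℕ→ℚ a

-- below w a t  :  w < a/2 - t * sqrt a      (for t ≥ 0)
below : ℕ → ℕ → ℚ → Bool
below w a t = (d <ᵇ ℕ→ℚ 0) ∧ ((ℕ→ℚ 4 * t * t * ℕ→ℚ a) <ᵇ (d * d))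
  where
  d = ℕ→ℚ (2 ℕ.* w) - ℕ→ℚ a

-- h^{(+,b)} on inputs of Hamming weight w out of a coordinates
hPlus : (c₁ : ℚ) (a : ℕ) → Bool → ℕ → Bool
hPlus c₁ a false w = false
hPlus c₁ a true  w = above w a c₁ ∨ below w a c₁

cube : (n : ℕ) → List (Vec Bool n)
cube zero    = [] ∷ []
cube (suc n) = List.map (false ∷_) (cube n) List.++ List.map (true ∷_) (cube n)

termSat : ∀ {n k} → Vec Bool n → (Fin k → Fin n) → Bool
termSat {k = k} x t = and (List.map (λ j → lookup x (t j)) (allFin k))

satTerms : ∀ {n k L} → Vec Bool n → (Fin L → Fin k → Fin n) → List (Fin L)
satTerms {L = L} x T = filterᵇ (λ ℓ → termSat x (T ℓ)) (allFin L)

-- f_yes determined by the parameters and the random choices (A, T, b)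
-- m = n - |A|;  |x_A| = ∣ x ∩ A ∣;  |x_C| = ∣ x ∩ ∁ A ∣
fYes : ∀ {n k L} (c₁ ε : ℚ) (A : Subset n) (T : Fin L → Fin k → Fin n)
       (b : Fin L → Bool) → Vec Bool n → Bool
fYes {n} c₁ ε A T b x with satTerms x T
... | _ ∷ _ ∷ _ = true
... | S = if above wC m (ε * (+ 1 / 20)) then true else rest S
  where
  a  = ∣ A ∣
  m  = n ∸ a
  wC = ∣ x ∩ ∁ A ∣
  wA = ∣ x ∩ A ∣
  rest : List _ → Bool
  rest []      = false
  rest (ℓ ∷ _) = if (2 ℕ.* wC) ℕ.<ᵇ m then false else hPlus c₁ a (b ℓ) wA

_≤ᵛ_ : ∀ {n} → Vec Bool n → Vec Bool n → Set
_≤ᵛ_ {n} x y = ∀ (i : Fin n) → lookup x i ≡ true → lookup y i ≡ true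

Monotone : ∀ {n} → (Vec Bool n → Bool) → Set
Monotone {n} f = ∀ (x y : Vec Bool n) → x ≤ᵛ y → f x ≡ true → f y ≡ true

disagree : ∀ {n} → (Vec Bool n → Bool) → (Vec Bool n → Bool) → ℕ
disagree {n} f g = length (filterᵇ (λ x → not (eqB (f x) (g x))) (cube n))
  where
  eqB : Bool → Bool → Bool
  eqB true true = true
  eqB false false = true
  eqB _ _ = false

CloseToMonotone : ∀ {n} → (Vec Bool n → Bool) → ℚ → Set
CloseToMonotone {n} f δ =
  Σ (Vec Bool n → Bool) λ g → Monotone g × (ℕ→ℚ (disagree f g) ≤ δ * ℕ→ℚ (2 ℕ.^ n))

IsFloorSqrtDiv : ℕ → ℚ → ℕ → Set
IsFloorSqrtDiv N ε a =
  (ℕ→ℚ (a ℕ.* a) * ε * ε ≤ ℕ→ℚ N) × (ℕ→ℚ N < ℕ→ℚ (suc a ℕ.* suc a) * ε * ε)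

tenth : ℚ
tenth = + 1 / 10

module Submission where

-- Let g be f_yes with h^{(+,b_ℓ)}(x_A) replaced by the constant b_ℓ. Then g is monotone:
-- S_T(x_C) only grows with x, the two thresholds on |x_C| are upward closed, and if x ≤ y
-- each satisfy exactly one term then it is the same term. f_yes and g differ only at points
-- where |x_A| lies within c₁√a of a/2 and |x_C| lies in [m/2, m/2 + 0.05ε√m]. Counting by
-- weights, these bands contain at most (21/20)·2c₁√a and (21/20)·0.05ε√m weights (the size
-- assumption ε ≥ c₀/√n with c₀ = 401 + 100/c₁² makes both widths at least 20), and every
-- binomial coefficient satisfies C(k,w)² ≤ 2·4ᵏ/(3k+2). Multiplying, f_yes and g differ on
-- at most (2/3)(21/20)²·0.1c₁ε·2ⁿ < 0.1c₁ε·2ⁿ points.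

module Rational where

  open import Defs using (ℕ→ℚ; _<ᵇ_)
  open import Data.Bool using (true; false; T)
  open import Data.Nat as ℕ using (ℕ)
  import Data.Nat.Properties as ℕ
  open import Data.Nat.Coprimality using (1-coprimeTo; sym)
  open import Data.Integer as ℤ using (+_)
  import Data.Integer.Properties as ℤ
  open import Data.Rational using (mkℚ; _/_; _+_; _*_; _-_; -_; _≤_; _<_; 0ℚ; *≤*; *<*; _≤ᵇ_; positive; nonNegative)
  open import Data.Rational.Properties
  open import Relation.Nullary.Decidable using (dec⇒maybe)
  open import Data.Sum using (inj₁; inj₂)
  open import Level using (0ℓ)
  open import Relation.Binary.PropositionalEquality hiding (sym)
  import Relation.Binary.PropositionalEquality as ≡
  open import Relation.Nullary using (¬_; contradiction)
  open import Tactic.RingSolver using (solve-∀)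
  open import Tactic.RingSolver.Core.AlmostCommutativeRing using (AlmostCommutativeRing; fromCommutativeRing)

  ℚ-ring : AlmostCommutativeRing 0ℓ 0ℓ
  ℚ-ring = fromCommutativeRing +-*-commutativeRing (λ x → dec⇒maybe (0ℚ ≟ x))

  ℕ→ℚ≡mkℚ : ∀ n → ℕ→ℚ n ≡ mkℚ (+ n) 0 (sym (1-coprimeTo n))
  ℕ→ℚ≡mkℚ n = normalize-coprime (sym (1-coprimeTo n))

  ℕ→ℚ-+ : ∀ m n → ℕ→ℚ (m ℕ.+ n) ≡ ℕ→ℚ m + ℕ→ℚ n
  ℕ→ℚ-+ m n rewrite ℕ→ℚ≡mkℚ m | ℕ→ℚ≡mkℚ n =
    cong (_/ 1) (≡.sym (trans (cong₂ ℤ._+_ (ℤ.+◃n≡+n (m ℕ.* 1)) (ℤ.+◃n≡+n (n ℕ.* 1)))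
                              (cong₂ (λ a b → + (a ℕ.+ b)) (ℕ.*-identityʳ m) (ℕ.*-identityʳ n))))

  ℕ→ℚ-* : ∀ m n → ℕ→ℚ (m ℕ.* n) ≡ ℕ→ℚ m * ℕ→ℚ n
  ℕ→ℚ-* m n rewrite ℕ→ℚ≡mkℚ m | ℕ→ℚ≡mkℚ n = cong (_/ 1) (≡.sym (ℤ.+◃n≡+n (m ℕ.* n)))

  <⇒≱ : ∀ {p q} → p < q → ¬ q ≤ p
  <⇒≱ p<q q≤p = <-irrefl refl (<-≤-trans p<q q≤p)

  ℕ→ℚ-mono-≤ : ∀ {m n} → m ℕ.≤ n → ℕ→ℚ m ≤ ℕ→ℚ n
  ℕ→ℚ-mono-≤ {m} {n} m≤n rewrite ℕ→ℚ≡mkℚ m | ℕ→ℚ≡mkℚ n =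
    *≤* (subst₂ ℤ._≤_ (≡.sym (ℤ.*-identityʳ (+ m))) (≡.sym (ℤ.*-identityʳ (+ n))) (ℤ.+≤+ m≤n))

  ℕ→ℚ-mono-< : ∀ {m n} → m ℕ.< n → ℕ→ℚ m < ℕ→ℚ n
  ℕ→ℚ-mono-< {m} {n} m<n rewrite ℕ→ℚ≡mkℚ m | ℕ→ℚ≡mkℚ n =
    *<* (subst₂ ℤ._<_ (≡.sym (ℤ.*-identityʳ (+ m))) (≡.sym (ℤ.*-identityʳ (+ n))) (ℤ.+<+ m<n))

  ℕ→ℚ-cancel-≤ : ∀ {m n} → ℕ→ℚ m ≤ ℕ→ℚ n → m ℕ.≤ n
  ℕ→ℚ-cancel-≤ m≤n = ℕ.≮⇒≥ λ n<m → <⇒≱ (ℕ→ℚ-mono-< n<m) m≤n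

  ℕ→ℚ-cancel-< : ∀ {m n} → ℕ→ℚ m < ℕ→ℚ n → m ℕ.< n
  ℕ→ℚ-cancel-< m<n = ℕ.≰⇒> λ n≤m → <⇒≱ m<n (ℕ→ℚ-mono-≤ n≤m)

  ℕ→ℚ-nonNeg : ∀ n → 0ℚ ≤ ℕ→ℚ n
  ℕ→ℚ-nonNeg n = ℕ→ℚ-mono-≤ {0} {n} ℕ.z≤n

  ℕ→ℚ-∸ : ∀ m n → n ℕ.≤ m → ℕ→ℚ (m ℕ.∸ n) ≡ ℕ→ℚ m - ℕ→ℚ n
  ℕ→ℚ-∸ m n n≤m = begin
    ℕ→ℚ (m ℕ.∸ n)                            ≡⟨ add-sub (ℕ→ℚ (m ℕ.∸ n)) (ℕ→ℚ n) ⟩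
    (ℕ→ℚ (m ℕ.∸ n) + ℕ→ℚ n) - ℕ→ℚ n          ≡⟨ cong (_- ℕ→ℚ n) (ℕ→ℚ-+ (m ℕ.∸ n) n) ⟨
    ℕ→ℚ (m ℕ.∸ n ℕ.+ n) - ℕ→ℚ n              ≡⟨ cong (λ k → ℕ→ℚ k - ℕ→ℚ n) (ℕ.m∸n+n≡m n≤m) ⟩
    ℕ→ℚ m - ℕ→ℚ n                            ∎
    where
    open ≡-Reasoning
    add-sub : ∀ p q → p ≡ (p + q) - q
    add-sub = solve-∀ ℚ-ring

  <ᵇ⇒< : ∀ {p q} → (p <ᵇ q) ≡ true → p < q
  <ᵇ⇒< {p} {q} p<ᵇq with q ≤ᵇ p in q≤ᵇp
  ... | false = ≰⇒> λ q≤p → subst T q≤ᵇp (≤⇒≤ᵇ q≤p)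

  <⇒<ᵇ : ∀ {p q} → p < q → (p <ᵇ q) ≡ true
  <⇒<ᵇ {p} {q} p<q with q ≤ᵇ p in q≤ᵇp
  ... | false = refl
  ... | true  = contradiction (≤ᵇ⇒≤ (subst T (≡.sym q≤ᵇp) _)) (<⇒≱ p<q)

  ≮ᵇ⇒≥ : ∀ {p q} → (p <ᵇ q) ≡ false → q ≤ p
  ≮ᵇ⇒≥ {p} {q} p≮ᵇq with q ≤ᵇ p in q≤ᵇp
  ... | true = ≤ᵇ⇒≤ (subst T (≡.sym q≤ᵇp) _)

  p≤p+q : ∀ p {q} → 0ℚ ≤ q → p ≤ p + q
  p≤p+q p {q} 0≤q = ≤-trans (≤-reflexive (≡.sym (+-identityʳ p))) (+-monoʳ-≤ p 0≤q)

  p≤q+p : ∀ p {q} → 0ℚ ≤ q → p ≤ q + p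
  p≤q+p p {q} 0≤q = ≤-trans (≤-reflexive (≡.sym (+-identityˡ p))) (+-monoˡ-≤ p 0≤q)

  *-nonNeg : ∀ {p q} → 0ℚ ≤ p → 0ℚ ≤ q → 0ℚ ≤ p * q
  *-nonNeg {p} {q} 0≤p 0≤q = nonNegative⁻¹ (p * q) {{nonNeg*nonNeg⇒nonNeg p {{nonNegative 0≤p}} q {{nonNegative 0≤q}}}}

  *-pos : ∀ {p q} → 0ℚ < p → 0ℚ < q → 0ℚ < p * q
  *-pos {p} {q} 0<p 0<q = positive⁻¹ (p * q) {{pos*pos⇒pos p {{positive 0<p}} q {{positive 0<q}}}}

  *-monoˡ-≤ : ∀ {p q r} → 0ℚ ≤ r → p ≤ q → r * p ≤ r * q
  *-monoˡ-≤ {r = r} 0≤r = *-monoˡ-≤-nonNeg r {{nonNegative 0≤r}}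

  *-monoʳ-≤ : ∀ {p q r} → 0ℚ ≤ r → p ≤ q → p * r ≤ q * r
  *-monoʳ-≤ {r = r} 0≤r = *-monoʳ-≤-nonNeg r {{nonNegative 0≤r}}

  *-mono-≤ : ∀ {p q r s} → 0ℚ ≤ p → 0ℚ ≤ r → p ≤ q → r ≤ s → p * r ≤ q * s
  *-mono-≤ 0≤p 0≤r p≤q r≤s = ≤-trans (*-monoʳ-≤ 0≤r p≤q) (*-monoˡ-≤ (≤-trans 0≤p p≤q) r≤s)

  *-monoˡ-< : ∀ {p q r} → 0ℚ < r → p < q → r * p < r * q
  *-monoˡ-< {r = r} 0<r = *-monoʳ-<-pos r {{positive 0<r}}

  *-cancelˡ-≤ : ∀ {p q r} → 0ℚ < r → r * p ≤ r * q → p ≤ q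
  *-cancelˡ-≤ {r = r} 0<r = *-cancelˡ-≤-pos r {{positive 0<r}}

  *-cancelʳ-≤ : ∀ {p q r} → 0ℚ < r → p * r ≤ q * r → p ≤ q
  *-cancelʳ-≤ {r = r} 0<r = *-cancelʳ-≤-pos r {{positive 0<r}}

  square-nonNeg : ∀ p → 0ℚ ≤ p * p
  square-nonNeg p with ≤-total 0ℚ p
  ... | inj₁ 0≤p = *-nonNeg 0≤p 0≤p
  ... | inj₂ p≤0 = subst (0ℚ ≤_) (neg*neg p) (*-nonNeg (neg-mono-≤ p≤0) (neg-mono-≤ p≤0))
    where
    neg-mono-≤ : ∀ {p} → p ≤ 0ℚ → 0ℚ ≤ - p
    neg-mono-≤ = neg-antimono-≤
    neg*neg : ∀ p → (- p) * (- p) ≡ p * p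
    neg*neg = solve-∀ ℚ-ring

  square-mono-≤ : ∀ {p q} → 0ℚ ≤ p → p ≤ q → p * p ≤ q * q
  square-mono-≤ 0≤p p≤q = *-mono-≤ 0≤p 0≤p p≤q p≤q

  square-mono-< : ∀ {p q} → 0ℚ ≤ p → p < q → p * p < q * q
  square-mono-< 0≤p p<q = ≤-<-trans (*-monoʳ-≤ 0≤p (<⇒≤ p<q)) (*-monoˡ-< (≤-<-trans 0≤p p<q) p<q)

  square-cancel-≤ : ∀ {p q} → 0ℚ ≤ q → p * p ≤ q * q → p ≤ q
  square-cancel-≤ 0≤q p²≤q² = ≮⇒≥ λ q<p → <⇒≱ (square-mono-< 0≤q q<p) p²≤q²

  square-cancel-< : ∀ {p q} → 0ℚ ≤ q → p * p < q * q → p < q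
  square-cancel-< 0≤q p²<q² = ≰⇒> λ q≤p → <⇒≱ p²<q² (square-mono-≤ 0≤q q≤p)

module Binomial where

  open import Data.Nat
  open import Data.Nat.Properties
  open import Data.Nat.Combinatorics using (_C_; nC1≡n; nCk≡nC[n∸k]; nCk+nC[k+1]≡[n+1]C[k+1])
  open import Data.Nat.Tactic.RingSolver using (solve-∀)
  open import Data.Product using (Σ-syntax; _×_; _,_)
  open import Data.Sum using (_⊎_; inj₁; inj₂)
  open import Function using (_∘′_)
  open import Relation.Binary.PropositionalEquality

  C-pascal : ∀ a w → suc a C suc w ≡ a C w + a C suc w
  C-pascal a w = sym (nCk+nC[k+1]≡[n+1]C[k+1] a w)

  -- (w+1)·C(a,w+1) = (a−w)·C(a,w), stated without truncated subtraction.
  C-absorption : ∀ a w → (a C suc w) * suc w + (a C w) * w ≡ (a C w) * a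
  C-absorption zero    zero    = refl
  C-absorption zero    (suc w) = refl
  C-absorption (suc a) zero    rewrite nC1≡n (suc a) = units (suc a)
    where
    units : ∀ a → a * 1 + 1 * 0 ≡ 1 * a
    units = solve-∀
  C-absorption (suc a) (suc w) rewrite C-pascal a w | C-pascal a (suc w) = begin
    (Y + Z) * suc (suc w) + (X + Y) * suc w                     ≡⟨ regroup X Y Z w ⟩
    (Z * suc (suc w) + Y * suc w) + (Y * suc w + X * w) + Y + X
      ≡⟨ cong₂ (λ u v → u + v + Y + X) (C-absorption a (suc w)) (C-absorption a w) ⟩
    Y * a + X * a + Y + X                                       ≡⟨ collect X Y a ⟩
    (X + Y) * suc a                                             ∎
    where
    open ≡-Reasoning
    X = a C w
    Y = a C suc w
    Z = a C suc (suc w)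
    regroup : ∀ X Y Z w → (Y + Z) * suc (suc w) + (X + Y) * suc w
                          ≡ (Z * suc (suc w) + Y * suc w) + (Y * suc w + X * w) + Y + X
    regroup = solve-∀
    collect : ∀ X Y a → Y * a + X * a + Y + X ≡ (X + Y) * suc a
    collect = solve-∀

  private
    double+1 : ∀ x w → x * suc w + x * w ≡ x * (2 * w + 1)
    double+1 = solve-∀

  C-increasing : ∀ {a w} → 2 * w + 1 ≤ a → a C w ≤ a C suc w
  C-increasing {a} {w} 2w+1≤a = *-cancelʳ-≤ (a C w) (a C suc w) (suc w) (+-cancelʳ-≤ ((a C w) * w) _ _ (begin
    (a C w) * suc w + (a C w) * w          ≡⟨ double+1 (a C w) w ⟩
    (a C w) * (2 * w + 1)                  ≤⟨ *-monoʳ-≤ (a C w) 2w+1≤a ⟩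
    (a C w) * a                            ≡⟨ C-absorption a w ⟨
    (a C suc w) * suc w + (a C w) * w      ∎))
    where open ≤-Reasoning

  C-decreasing : ∀ {a w} → a ≤ 2 * w + 1 → a C suc w ≤ a C w
  C-decreasing {a} {w} a≤2w+1 = *-cancelʳ-≤ (a C suc w) (a C w) (suc w) (+-cancelʳ-≤ ((a C w) * w) _ _ (begin
    (a C suc w) * suc w + (a C w) * w      ≡⟨ C-absorption a w ⟩
    (a C w) * a                            ≤⟨ *-monoʳ-≤ (a C w) a≤2w+1 ⟩
    (a C w) * (2 * w + 1)                  ≡⟨ double+1 (a C w) w ⟨
    (a C w) * suc w + (a C w) * w          ∎))
    where open ≤-Reasoning

  ≤-upTo : ∀ (f : ℕ → ℕ) {h} → (∀ {w} → w < h → f w ≤ f (suc w)) → ∀ {w} → w ≤ h → f w ≤ f h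
  ≤-upTo f {zero}  step z≤n = ≤-refl
  ≤-upTo f {suc h} step w≤1+h with m≤n⇒m<n∨m≡n w≤1+h
  ... | inj₂ refl     = ≤-refl
  ... | inj₁ (s≤s w≤h) = ≤-trans (≤-upTo f (step ∘′ m<n⇒m<1+n) w≤h) (step (n<1+n h))

  ≤-downFrom : ∀ (f : ℕ → ℕ) {h} → (∀ {w} → h ≤ w → f (suc w) ≤ f w) → ∀ {w} → h ≤ w → f w ≤ f h
  ≤-downFrom f step {zero}  z≤n = ≤-refl
  ≤-downFrom f step {suc w} h≤1+w with m≤n⇒m<n∨m≡n h≤1+w
  ... | inj₂ refl     = ≤-refl
  ... | inj₁ (s≤s h≤w) = ≤-trans (step h≤w) (≤-downFrom f step h≤w)

  C-≤-middle : ∀ a h → 2 * h ≤ suc a → a ≤ suc (2 * h) → ∀ w → a C w ≤ a C h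
  C-≤-middle a h 2h≤1+a a≤1+2h w with ≤-total w h
  ... | inj₁ w≤h = ≤-upTo (a C_) (λ w<h → C-increasing (lower w<h)) w≤h
    where
    lower : ∀ {w} → w < h → 2 * w + 1 ≤ a
    lower {w} w<h = ≤-pred (begin
      suc (2 * w + 1) ≡⟨ cong suc (+-comm (2 * w) 1) ⟩
      2 + 2 * w       ≡⟨ *-distribˡ-+ 2 1 w ⟨
      2 * suc w       ≤⟨ *-monoʳ-≤ 2 w<h ⟩
      2 * h           ≤⟨ 2h≤1+a ⟩
      suc a           ∎)
      where open ≤-Reasoning
  ... | inj₂ h≤w = ≤-downFrom (a C_) (λ h≤w → C-decreasing (upper h≤w)) h≤w
    where
    upper : ∀ {w} → h ≤ w → a ≤ 2 * w + 1
    upper {w} h≤w = begin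
      a           ≤⟨ a≤1+2h ⟩
      suc (2 * h) ≤⟨ s≤s (*-monoʳ-≤ 2 h≤w) ⟩
      suc (2 * w) ≡⟨ +-comm 1 (2 * w) ⟩
      2 * w + 1   ∎
      where open ≤-Reasoning

  centralC : ℕ → ℕ
  centralC k = (k + k) C k

  oddC-symmetric : ∀ k → suc (k + k) C k ≡ suc (k + k) C suc k
  oddC-symmetric k = begin
    suc (k + k) C k                ≡⟨ nCk≡nC[n∸k] (m≤n⇒m≤1+n (m≤m+n k k)) ⟩
    suc (k + k) C (suc (k + k) ∸ k) ≡⟨ cong (λ n → suc (k + k) C (n ∸ k)) (+-suc k k) ⟨
    suc (k + k) C (k + suc k ∸ k)   ≡⟨ cong (suc (k + k) C_) (m+n∸m≡n k (suc k)) ⟩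
    suc (k + k) C suc k             ∎
    where open ≡-Reasoning

  centralC-suc : ∀ k → centralC (suc k) ≡ 2 * (suc (k + k) C suc k)
  centralC-suc k = begin
    suc (k + suc k) C suc k                        ≡⟨ cong (λ n → suc n C suc k) (+-suc k k) ⟩
    suc (suc (k + k)) C suc k                      ≡⟨ C-pascal (suc (k + k)) k ⟩
    suc (k + k) C k + suc (k + k) C suc k          ≡⟨ cong (_+ suc (k + k) C suc k) (oddC-symmetric k) ⟩
    suc (k + k) C suc k + suc (k + k) C suc k      ≡⟨ cong (suc (k + k) C suc k +_) (+-identityʳ _) ⟨
    2 * (suc (k + k) C suc k)                      ∎
    where open ≡-Reasoning

  oddC-absorption : ∀ k → (suc (k + k) C suc k) * suc k ≡ centralC k * suc (k + k)
  oddC-absorption k = begin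
    (suc (k + k) C suc k) * suc k                  ≡⟨ cong (_* suc k) (C-pascal (k + k) k) ⟩
    (c + (k + k) C suc k) * suc k                  ≡⟨ *-distribʳ-+ (suc k) c ((k + k) C suc k) ⟩
    c * suc k + ((k + k) C suc k) * suc k          ≡⟨ cong (c * suc k +_) upper ⟩
    c * suc k + c * k                              ≡⟨ collect c k ⟩
    c * suc (k + k)                                ∎
    where
    open ≡-Reasoning
    c = centralC k
    collect : ∀ c k → c * suc k + c * k ≡ c * suc (k + k)
    collect = solve-∀
    split : ∀ c k → c * (k + k) ≡ c * k + c * k
    split = solve-∀
    upper : ((k + k) C suc k) * suc k ≡ c * k
    upper = +-cancelʳ-≡ _ _ (c * k) (trans (C-absorption (k + k) k) (split c k))

  centralC-step : ∀ k → centralC (suc k) * suc k ≡ 2 * (centralC k * suc (k + k))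
  centralC-step k = begin
    centralC (suc k) * suc k                 ≡⟨ cong (_* suc k) (centralC-suc k) ⟩
    2 * (suc (k + k) C suc k) * suc k        ≡⟨ *-assoc 2 (suc (k + k) C suc k) (suc k) ⟩
    2 * ((suc (k + k) C suc k) * suc k)      ≡⟨ cong (2 *_) (oddC-absorption k) ⟩
    2 * (centralC k * suc (k + k))           ∎
    where open ≡-Reasoning

  centralC-bound : ∀ k → centralC k * centralC k * (3 * k + 1) ≤ 4 ^ (k + k)
  centralC-bound zero    = ≤-refl
  centralC-bound (suc k) = *-cancelˡ-≤ (suc k * suc k) (begin
    suc k * suc k * (c′ * c′ * (3 * suc k + 1))                       ≡⟨ regroup c′ k ⟩
    (c′ * suc k) * (c′ * suc k) * (3 * k + 4)                         ≡⟨ cong (λ z → z * z * (3 * k + 4)) (centralC-step k) ⟩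
    2 * (c * suc (k + k)) * (2 * (c * suc (k + k))) * (3 * k + 4)     ≤⟨ m≤m+n _ (4 * k * (c * c)) ⟩
    2 * (c * suc (k + k)) * (2 * (c * suc (k + k))) * (3 * k + 4) + 4 * k * (c * c)
                                                                      ≡⟨ expand c k ⟩
    suc k * suc k * (16 * (c * c * (3 * k + 1)))                      ≤⟨ *-monoʳ-≤ (suc k * suc k) (*-monoʳ-≤ 16 (centralC-bound k)) ⟩
    suc k * suc k * (16 * 4 ^ (k + k))                                ≡⟨ cong (suc k * suc k *_) 4^[2+2k] ⟨
    suc k * suc k * 4 ^ (suc k + suc k)                               ∎)
    where
    open ≤-Reasoning
    c = centralC k
    c′ = centralC (suc k)
    4^[2+2k] : 4 ^ (suc k + suc k) ≡ 16 * 4 ^ (k + k)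
    4^[2+2k] rewrite +-suc k k = sym (*-assoc 4 4 (4 ^ (k + k)))
    regroup : ∀ c′ k → suc k * suc k * (c′ * c′ * (3 * suc k + 1)) ≡ (c′ * suc k) * (c′ * suc k) * (3 * k + 4)
    regroup = solve-∀
    expand : ∀ c k → 2 * (c * suc (k + k)) * (2 * (c * suc (k + k))) * (3 * k + 4) + 4 * k * (c * c)
                     ≡ suc k * suc k * (16 * (c * c * (3 * k + 1)))
    expand = solve-∀

  even⊎odd : ∀ a → Σ[ k ∈ ℕ ] (a ≡ k + k ⊎ a ≡ suc (k + k))
  even⊎odd zero = 0 , inj₁ refl
  even⊎odd (suc a) with even⊎odd a
  ... | k , inj₁ refl = k , inj₂ refl
  ... | k , inj₂ refl = suc k , inj₁ (cong suc (sym (+-suc k k)))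

  evenC-max-bound : ∀ k → (∀ w → (k + k) C w ≤ centralC k) × (centralC k * centralC k * (3 * (k + k) + 2) ≤ 2 * 4 ^ (k + k))
  evenC-max-bound k = C-≤-middle (k + k) k (m≤n⇒m≤1+n 2k≤k+k) (m≤n⇒m≤1+n k+k≤2k) , (begin
    c * c * (3 * (k + k) + 2)     ≡⟨ double c k ⟩
    2 * (c * c * (3 * k + 1))     ≤⟨ *-monoʳ-≤ 2 (centralC-bound k) ⟩
    2 * 4 ^ (k + k)               ∎)
    where
    open ≤-Reasoning
    c = centralC k
    2k≤k+k : 2 * k ≤ k + k
    2k≤k+k = ≤-reflexive (cong (k +_) (+-identityʳ k))
    k+k≤2k : k + k ≤ 2 * k
    k+k≤2k = ≤-reflexive (cong (k +_) (sym (+-identityʳ k)))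
    double : ∀ c k → c * c * (3 * (k + k) + 2) ≡ 2 * (c * c * (3 * k + 1))
    double = solve-∀

  oddC-max-bound : ∀ k → let Y = suc (k + k) C suc k in
    (∀ w → suc (k + k) C w ≤ Y) × (Y * Y * (3 * suc (k + k) + 2) ≤ 2 * 4 ^ suc (k + k))
  oddC-max-bound k = C-≤-middle (suc (k + k)) (suc k) (≤-reflexive 2[1+k]≡2+2k) 1+2k≤3+2k , (begin
    Y * Y * (3 * suc (k + k) + 2)                ≤⟨ m≤m+n _ (3 * (Y * Y)) ⟩
    Y * Y * (3 * suc (k + k) + 2) + 3 * (Y * Y)  ≡⟨ double Y k ⟩
    2 * (Y * Y * (3 * k + 4))                    ≤⟨ *-monoʳ-≤ 2 Y²[3k+4]≤ ⟩
    2 * 4 ^ suc (k + k)                          ∎)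
    where
    open ≤-Reasoning
    Y = suc (k + k) C suc k
    2[1+k]≡2+2k : 2 * suc k ≡ suc (suc (k + k))
    2[1+k]≡2+2k = cong suc (trans (cong (k +_) (+-identityʳ (suc k))) (+-suc k k))
    1+2k≤3+2k : suc (k + k) ≤ suc (2 * suc k)
    1+2k≤3+2k = ≤-trans (n≤1+n _) (≤-trans (n≤1+n _) (≤-reflexive (cong suc (sym 2[1+k]≡2+2k))))
    double : ∀ Y k → Y * Y * (3 * suc (k + k) + 2) + 3 * (Y * Y) ≡ 2 * (Y * Y * (3 * k + 4))
    double = solve-∀
    quadruple : ∀ Y k → 4 * (Y * Y * (3 * k + 4)) ≡ (2 * Y) * (2 * Y) * (3 * suc k + 1)
    quadruple = solve-∀
    Y²[3k+4]≤ : Y * Y * (3 * k + 4) ≤ 4 ^ suc (k + k)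
    Y²[3k+4]≤ = *-cancelˡ-≤ 4 (begin
      4 * (Y * Y * (3 * k + 4))                              ≡⟨ quadruple Y k ⟩
      (2 * Y) * (2 * Y) * (3 * suc k + 1)                    ≡⟨ cong (λ z → z * z * (3 * suc k + 1)) (centralC-suc k) ⟨
      centralC (suc k) * centralC (suc k) * (3 * suc k + 1)  ≤⟨ centralC-bound (suc k) ⟩
      4 ^ (suc k + suc k)                                    ≡⟨ cong (λ n → 4 ^ suc n) (+-suc k k) ⟩
      4 * 4 ^ suc (k + k)                                    ∎)

  C-max-bound : ∀ a → Σ[ M ∈ ℕ ] (∀ w → a C w ≤ M) × (M * M * (3 * a + 2) ≤ 2 * 4 ^ a)
  C-max-bound a with even⊎odd a
  ... | k , inj₁ refl = centralC k , evenC-max-bound k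
  ... | k , inj₂ refl = suc (k + k) C suc k , oddC-max-bound k

module Counting where

  open import Defs using (cube; disagree)
  open import Data.Bool using (Bool; true; false; _∧_)
  open import Data.Nat
  open import Data.Nat.Properties
  open import Data.Nat.Combinatorics using (_C_)
  open Binomial using (C-pascal)
  open import Data.Fin.Subset using (Subset; ∁; _∩_; ∣_∣; inside; outside)
  open import Data.List using (List; []; _∷_; _++_; map; filterᵇ; length)
  open import Data.List.Properties using (filter-++; length-++)
  open import Data.Vec using (Vec; []; _∷_)
  open import Data.Product using (Σ-syntax; _×_; _,_)
  open import Data.Sum using (_⊎_; inj₁; inj₂)
  open import Function using (_∘_)
  open import Relation.Binary.PropositionalEquality
  open import Algebra.Properties.CommutativeSemigroup +-commutativeSemigroup using () renaming (interchange to +-interchange)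

  indicator : Bool → ℕ
  indicator true  = 1
  indicator false = 0

  ∑< : ℕ → (ℕ → ℕ) → ℕ
  ∑< zero    f = 0
  ∑< (suc N) f = f 0 + ∑< N (f ∘ suc)

  syntax ∑< N (λ w → e) = ∑[ w < N ] e

  ∑-cong : ∀ N {f g : ℕ → ℕ} → (∀ w → f w ≡ g w) → ∑< N f ≡ ∑< N g
  ∑-cong zero    f≗g = refl
  ∑-cong (suc N) f≗g = cong₂ _+_ (f≗g 0) (∑-cong N (f≗g ∘ suc))

  ∑-distrib-+ : ∀ N (f g : ℕ → ℕ) → ∑[ w < N ] (f w + g w) ≡ ∑< N f + ∑< N g
  ∑-distrib-+ zero    f g = refl
  ∑-distrib-+ (suc N) f g = begin
    (f 0 + g 0) + ∑[ w < N ] (f (suc w) + g (suc w)) ≡⟨ cong ((f 0 + g 0) +_) (∑-distrib-+ N (f ∘ suc) (g ∘ suc)) ⟩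
    (f 0 + g 0) + (∑< N (f ∘ suc) + ∑< N (g ∘ suc))  ≡⟨ +-interchange (f 0) (g 0) _ _ ⟩
    (f 0 + ∑< N (f ∘ suc)) + (g 0 + ∑< N (g ∘ suc))  ∎
    where open ≡-Reasoning

  ∑-mono-≤ : ∀ N {f g : ℕ → ℕ} → (∀ w → f w ≤ g w) → ∑< N f ≤ ∑< N g
  ∑-mono-≤ zero    f≤g = z≤n
  ∑-mono-≤ (suc N) f≤g = +-mono-≤ (f≤g 0) (∑-mono-≤ N (f≤g ∘ suc))

  ∑-distribˡ-* : ∀ N M (f : ℕ → ℕ) → ∑[ w < N ] (M * f w) ≡ M * ∑< N f
  ∑-distribˡ-* zero    M f = sym (*-zeroʳ M)
  ∑-distribˡ-* (suc N) M f = trans (cong (M * f 0 +_) (∑-distribˡ-* N M (f ∘ suc))) (sym (*-distribˡ-+ M (f 0) _))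

  ∑-zero : ∀ N → ∑[ w < N ] 0 ≡ 0
  ∑-zero zero    = refl
  ∑-zero (suc N) = ∑-zero N

  count : ℕ → (ℕ → Bool) → ℕ
  count N Q = ∑[ w < N ] indicator (Q w)

  count≡0⊎spanned : ∀ N Q → count N Q ≡ 0
    ⊎ Σ[ f ∈ ℕ ] Σ[ t ∈ ℕ ] Q f ≡ true × Q t ≡ true × f ≤ t × count N Q ≤ suc (t ∸ f)
  count≡0⊎spanned zero    Q = inj₁ refl
  count≡0⊎spanned (suc N) Q with Q 0 in Q0 | count≡0⊎spanned N (Q ∘ suc)
  ... | false | inj₁ none = inj₁ none
  ... | true  | inj₁ none = inj₂ (0 , 0 , Q0 , Q0 , z≤n , s≤s (≤-reflexive none))
  ... | false | inj₂ (f , t , Qf , Qt , f≤t , c≤) = inj₂ (suc f , suc t , Qf , Qt , s≤s f≤t , c≤)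
  ... | true  | inj₂ (f , t , Qf , Qt , f≤t , c≤) =
    inj₂ (0 , suc t , Q0 , Qt , z≤n , s≤s (≤-trans c≤ (s≤s (m∸n≤m t f))))

  -- The number of points y ∈ {0,1}ᵃ whose Hamming weight |y| satisfies Q.
  weightCount : ℕ → (ℕ → Bool) → ℕ
  weightCount zero    Q = indicator (Q 0)
  weightCount (suc a) Q = weightCount a Q + weightCount a (Q ∘ suc)

  weightCount-∑ : ∀ a Q {N} → a < N → weightCount a Q ≡ ∑[ w < N ] ((a C w) * indicator (Q w))
  weightCount-∑ zero    Q {suc N} _ = sym (trans (cong₂ _+_ (+-identityʳ (indicator (Q 0))) (∑-zero N)) (+-identityʳ _))
  weightCount-∑ (suc a) Q {suc N} (s≤s a<N) = begin
    weightCount a Q + weightCount a (Q ∘ suc)   ≡⟨ cong₂ _+_ (weightCount-∑ a Q (m<n⇒m<1+n a<N)) (weightCount-∑ a (Q ∘ suc) a<N) ⟩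
    (q₀ + S₂) + S₁                              ≡⟨ +-assoc q₀ S₂ S₁ ⟩
    q₀ + (S₂ + S₁)                              ≡⟨ cong (q₀ +_) (+-comm S₂ S₁) ⟩
    q₀ + (S₁ + S₂)                              ≡⟨ cong (q₀ +_) (∑-distrib-+ N _ _) ⟨
    q₀ + ∑[ w < N ] ((a C w) * q (suc w) + (a C suc w) * q (suc w))
                                                ≡⟨ cong (q₀ +_) (∑-cong N pascal) ⟩
    q₀ + ∑[ w < N ] ((suc a C suc w) * q (suc w)) ∎
    where
    open ≡-Reasoning
    q : ℕ → ℕ
    q w = indicator (Q w)
    q₀ = 1 * q 0
    S₁ = ∑[ w < N ] ((a C w) * q (suc w))
    S₂ = ∑[ w < N ] ((a C suc w) * q (suc w))
    pascal : ∀ w → (a C w) * q (suc w) + (a C suc w) * q (suc w) ≡ (suc a C suc w) * q (suc w)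
    pascal w = trans (sym (*-distribʳ-+ (q (suc w)) (a C w) (a C suc w))) (cong (_* q (suc w)) (sym (C-pascal a w)))

  weightCount-≤ : ∀ a Q {M} → (∀ w → a C w ≤ M) → weightCount a Q ≤ M * count (suc a) Q
  weightCount-≤ a Q {M} C≤M = begin
    weightCount a Q                               ≡⟨ weightCount-∑ a Q ≤-refl ⟩
    ∑[ w < suc a ] ((a C w) * indicator (Q w))    ≤⟨ ∑-mono-≤ (suc a) (λ w → *-monoˡ-≤ (indicator (Q w)) (C≤M w)) ⟩
    ∑[ w < suc a ] (M * indicator (Q w))          ≡⟨ ∑-distribˡ-* (suc a) M (indicator ∘ Q) ⟩
    M * count (suc a) Q                           ∎
    where open ≤-Reasoning

  #cube : ∀ {n} → (Vec Bool n → Bool) → ℕ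
  #cube {n} p = length (filterᵇ p (cube n))

  length-filterᵇ-map : ∀ {A B : Set} (p : B → Bool) (f : A → B) xs →
    length (filterᵇ p (map f xs)) ≡ length (filterᵇ (p ∘ f) xs)
  length-filterᵇ-map p f []       = refl
  length-filterᵇ-map p f (x ∷ xs) with p (f x)
  ... | true  = cong suc (length-filterᵇ-map p f xs)
  ... | false = length-filterᵇ-map p f xs

  #cube-suc : ∀ {n} (p : Vec Bool (suc n) → Bool) → #cube p ≡ #cube (p ∘ (false ∷_)) + #cube (p ∘ (true ∷_))
  #cube-suc {n} p = begin
    length (filterᵇ p (map (false ∷_) (cube n) ++ map (true ∷_) (cube n)))
      ≡⟨ cong length (filter-++ _ (map (false ∷_) (cube n)) _) ⟩
    length (filterᵇ p (map (false ∷_) (cube n)) ++ filterᵇ p (map (true ∷_) (cube n)))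
      ≡⟨ length-++ (filterᵇ p (map (false ∷_) (cube n))) ⟩
    length (filterᵇ p (map (false ∷_) (cube n))) + length (filterᵇ p (map (true ∷_) (cube n)))
      ≡⟨ cong₂ _+_ (length-filterᵇ-map p _ (cube n)) (length-filterᵇ-map p _ (cube n)) ⟩
    #cube (p ∘ (false ∷_)) + #cube (p ∘ (true ∷_))
      ∎
    where open ≡-Reasoning

  #cube-weights : ∀ {n} (A : Subset n) (QA QC : ℕ → Bool) →
    #cube (λ x → QA (∣ x ∩ A ∣) ∧ QC (∣ x ∩ ∁ A ∣)) ≡ weightCount (∣ A ∣) QA * weightCount (∣ ∁ A ∣) QC
  #cube-weights [] QA QC with QA 0 | QC 0
  ... | true  | true  = refl
  ... | true  | false = refl
  ... | false | _     = refl
  #cube-weights {suc n} (inside ∷ A) QA QC = begin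
    #cube (λ x → QA (∣ x ∩ (inside ∷ A) ∣) ∧ QC (∣ x ∩ ∁ (inside ∷ A) ∣))  ≡⟨ #cube-suc {n} _ ⟩
    #cube (λ x → QA (∣ x ∩ A ∣) ∧ QC (∣ x ∩ ∁ A ∣)) + #cube (λ x → QA (suc ∣ x ∩ A ∣) ∧ QC (∣ x ∩ ∁ A ∣))
                                                                          ≡⟨ cong₂ _+_ (#cube-weights A QA QC) (#cube-weights A (QA ∘ suc) QC) ⟩
    wA * wC + weightCount (∣ A ∣) (QA ∘ suc) * wC                          ≡⟨ *-distribʳ-+ wC wA _ ⟨
    weightCount (suc ∣ A ∣) QA * wC                                       ∎
    where
    open ≡-Reasoning
    wA = weightCount (∣ A ∣) QA
    wC = weightCount (∣ ∁ A ∣) QC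
  #cube-weights {suc n} (outside ∷ A) QA QC = begin
    #cube (λ x → QA (∣ x ∩ (outside ∷ A) ∣) ∧ QC (∣ x ∩ ∁ (outside ∷ A) ∣)) ≡⟨ #cube-suc {n} _ ⟩
    #cube (λ x → QA (∣ x ∩ A ∣) ∧ QC (∣ x ∩ ∁ A ∣)) + #cube (λ x → QA (∣ x ∩ A ∣) ∧ QC (suc ∣ x ∩ ∁ A ∣))
                                                                          ≡⟨ cong₂ _+_ (#cube-weights A QA QC) (#cube-weights A QA (QC ∘ suc)) ⟩
    wA * wC + wA * weightCount (∣ ∁ A ∣) (QC ∘ suc)                         ≡⟨ *-distribˡ-+ wA wC _ ⟨
    wA * weightCount (suc ∣ ∁ A ∣) QC                                     ∎
    where
    open ≡-Reasoning
    wA = weightCount (∣ A ∣) QA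
    wC = weightCount (∣ ∁ A ∣) QC

  disagree-≤ : ∀ {n} (f g q : Vec Bool n → Bool) → (∀ x → f x ≡ g x ⊎ q x ≡ true) → disagree f g ≤ #cube q
  disagree-≤ {zero} f g q agree with f [] | g [] | agree []
  ... | true  | true  | _       = z≤n
  ... | false | false | _       = z≤n
  ... | true  | false | inj₂ q[] rewrite q[] = ≤-refl
  ... | false | true  | inj₂ q[] rewrite q[] = ≤-refl
  disagree-≤ {suc n} f g q agree = begin
    disagree f g                                                            ≡⟨ #cube-suc {n} _ ⟩
    disagree (f ∘ (false ∷_)) (g ∘ (false ∷_)) + disagree (f ∘ (true ∷_)) (g ∘ (true ∷_))
                                                                            ≤⟨ +-mono-≤ (disagree-≤ _ _ _ (agree ∘ (false ∷_))) (disagree-≤ _ _ _ (agree ∘ (true ∷_))) ⟩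
    #cube (q ∘ (false ∷_)) + #cube (q ∘ (true ∷_))                          ≡⟨ #cube-suc q ⟨
    #cube q                                                                 ∎
    where open ≤-Reasoning

module Threshold where

  open import Defs using (ℕ→ℚ; _<ᵇ_; above; below)
  open Rational
  open import Data.Bool using (Bool; true; false; not; _∧_; _∨_; T)
  open import Data.Bool.Properties using (∧-conicalˡ; ∧-conicalʳ; ∨-conicalˡ; ∨-conicalʳ; not-injective)
  open import Data.Nat as ℕ using (ℕ; _∸_)
  import Data.Nat.Properties as ℕ
  open import Data.Rational using (ℚ; _+_; _*_; _-_; -_; _≤_; _<_; 0ℚ)
  open import Data.Rational.Properties
    using (≤-trans; ≤-reflexive; <⇒≤; <-≤-trans; <-cmp; +-inverseʳ; +-mono-≤; +-monoˡ-≤; module ≤-Reasoning)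
  open import Data.Product using (_×_; _,_; proj₁; proj₂)
  open import Relation.Binary.Definitions using (tri<; tri≈; tri>)
  open import Relation.Binary.PropositionalEquality
  open import Relation.Nullary using (contradiction)
  open import Tactic.RingSolver using (solve-∀)

  offset : ℕ → ℕ → ℚ
  offset w a = ℕ→ℚ (2 ℕ.* w) - ℕ→ℚ a

  radius² : ℕ → ℚ → ℚ
  radius² a t = ℕ→ℚ 4 * t * t * ℕ→ℚ a

  radius²-nonNeg : ∀ a t → 0ℚ ≤ radius² a t
  radius²-nonNeg a t = ≤-trans (*-nonNeg (*-nonNeg (ℕ→ℚ-nonNeg 4) (square-nonNeg t)) (ℕ→ℚ-nonNeg a))
                               (≤-reflexive (reassoc (ℕ→ℚ 4) t (ℕ→ℚ a)))
    where
    reassoc : ∀ f t a → f * (t * t) * a ≡ f * t * t * a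
    reassoc = solve-∀ ℚ-ring

  ∧-false⁻ : ∀ {b c} → b ∧ c ≡ false → b ≡ true → c ≡ false
  ∧-false⁻ c≡false refl = c≡false

  above⇒ : ∀ w a t → above w a t ≡ true → 0ℚ < offset w a × radius² a t < offset w a * offset w a
  above⇒ w a t h = <ᵇ⇒< (∧-conicalˡ _ _ h) , <ᵇ⇒< (∧-conicalʳ _ _ h)

  above⇐ : ∀ w a t → 0ℚ < offset w a → radius² a t < offset w a * offset w a → above w a t ≡ true
  above⇐ w a t pos far = cong₂ _∧_ (<⇒<ᵇ pos) (<⇒<ᵇ far)

  ¬above⇒ : ∀ w a t → above w a t ≡ false → 0ℚ < offset w a → offset w a * offset w a ≤ radius² a t
  ¬above⇒ w a t h pos = ≮ᵇ⇒≥ (∧-false⁻ h (<⇒<ᵇ pos))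

  ¬below⇒ : ∀ w a t → below w a t ≡ false → offset w a < 0ℚ → offset w a * offset w a ≤ radius² a t
  ¬below⇒ w a t h neg = ≮ᵇ⇒≥ (∧-false⁻ h (<⇒<ᵇ neg))

  offset-mono-≤ : ∀ {w w′} a → w ℕ.≤ w′ → offset w a ≤ offset w′ a
  offset-mono-≤ {w} {w′} a w≤w′ = +-monoˡ-≤ (- ℕ→ℚ a) (ℕ→ℚ-mono-≤ {2 ℕ.* w} {2 ℕ.* w′} (ℕ.*-monoʳ-≤ 2 w≤w′))

  offset-nonNeg : ∀ {w a} → a ℕ.≤ 2 ℕ.* w → 0ℚ ≤ offset w a
  offset-nonNeg {w} {a} a≤2w =
    ≤-trans (≤-reflexive (sym (+-inverseʳ (ℕ→ℚ a)))) (+-monoˡ-≤ (- ℕ→ℚ a) (ℕ→ℚ-mono-≤ {a} {2 ℕ.* w} a≤2w))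

  offset-∸ : ∀ {f t} a → f ℕ.≤ t → offset t a ≡ offset f a + ℕ→ℚ 2 * ℕ→ℚ (t ∸ f)
  offset-∸ {f} {t} a f≤t = begin
    ℕ→ℚ (2 ℕ.* t) - ℕ→ℚ a                                   ≡⟨ cong (λ n → ℕ→ℚ (2 ℕ.* n) - ℕ→ℚ a) (ℕ.m+[n∸m]≡n f≤t) ⟨
    ℕ→ℚ (2 ℕ.* (f ℕ.+ (t ∸ f))) - ℕ→ℚ a                     ≡⟨ cong (λ n → ℕ→ℚ n - ℕ→ℚ a) (ℕ.*-distribˡ-+ 2 f (t ∸ f)) ⟩
    ℕ→ℚ (2 ℕ.* f ℕ.+ 2 ℕ.* (t ∸ f)) - ℕ→ℚ a                 ≡⟨ cong (_- ℕ→ℚ a) (trans (ℕ→ℚ-+ (2 ℕ.* f) _) (cong (ℕ→ℚ (2 ℕ.* f) +_) (ℕ→ℚ-* 2 (t ∸ f)))) ⟩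
    (ℕ→ℚ (2 ℕ.* f) + ℕ→ℚ 2 * ℕ→ℚ (t ∸ f)) - ℕ→ℚ a          ≡⟨ swap (ℕ→ℚ (2 ℕ.* f)) _ (ℕ→ℚ a) ⟩
    (ℕ→ℚ (2 ℕ.* f) - ℕ→ℚ a) + ℕ→ℚ 2 * ℕ→ℚ (t ∸ f)          ∎
    where
    open ≡-Reasoning
    swap : ∀ x y z → (x + y) - z ≡ (x - z) + y
    swap = solve-∀ ℚ-ring

  above-mono : ∀ {w w′} a t → w ℕ.≤ w′ → above w a t ≡ true → above w′ a t ≡ true
  above-mono {w} {w′} a t w≤w′ h =
    let pos , far = above⇒ w a t h in
    above⇐ w′ a t (<-≤-trans pos (offset-mono-≤ a w≤w′))
                                  (<-≤-trans far (square-mono-≤ (<⇒≤ pos) (offset-mono-≤ a w≤w′)))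

  ≮ᵇ⇒≥ᴺ : ∀ {m n} → (m ℕ.<ᵇ n) ≡ false → n ℕ.≤ m
  ≮ᵇ⇒≥ᴺ m≮ᵇn = ℕ.≮⇒≥ λ m<n → subst T m≮ᵇn (ℕ.<⇒<ᵇ m<n)

  ≥⇒≮ᵇᴺ : ∀ {m n} → n ℕ.≤ m → (m ℕ.<ᵇ n) ≡ false
  ≥⇒≮ᵇᴺ {m} {n} n≤m with m ℕ.<ᵇ n in m<ᵇn
  ... | false = refl
  ... | true  = contradiction (ℕ.<ᵇ⇒< m n (subst T (sym m<ᵇn) _)) (ℕ.≤⇒≯ n≤m)

  belowHalf-mono : ∀ {w w′} m → w ℕ.≤ w′ → (2 ℕ.* w ℕ.<ᵇ m) ≡ false → (2 ℕ.* w′ ℕ.<ᵇ m) ≡ false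
  belowHalf-mono {w} m w≤w′ h = ≥⇒≮ᵇᴺ (ℕ.≤-trans (≮ᵇ⇒≥ᴺ {2 ℕ.* w} {m} h) (ℕ.*-monoʳ-≤ 2 w≤w′))

  central : ℚ → ℕ → ℕ → Bool
  central c a w = not (above w a c ∨ below w a c)

  middle : ℕ → ℚ → ℕ → Bool
  middle m t w = not (2 ℕ.* w ℕ.<ᵇ m) ∧ not (above w m t)

  square-≤-bySign : ∀ d K → 0ℚ ≤ K → (0ℚ < d → d * d ≤ K) → (d < 0ℚ → d * d ≤ K) → d * d ≤ K
  square-≤-bySign d K 0≤K pos neg with <-cmp d 0ℚ
  ... | tri< d<0 _ _    = neg d<0
  ... | tri≈ _ refl _   = 0≤K
  ... | tri> _ _ 0<d    = pos 0<d

  central⇒ : ∀ c a w → central c a w ≡ true → offset w a * offset w a ≤ radius² a c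
  central⇒ c a w h =
    square-≤-bySign (offset w a) (radius² a c) (radius²-nonNeg a c)
      (¬above⇒ w a c (∨-conicalˡ (above w a c) (below w a c) (not-injective h)))
      (¬below⇒ w a c (∨-conicalʳ (above w a c) (below w a c) (not-injective h)))

  middle⇒ : ∀ m t w → middle m t w ≡ true → 0ℚ ≤ offset w m × offset w m * offset w m ≤ radius² m t
  middle⇒ m t w h = 0≤offset , square-≤-bySign (offset w m) (radius² m t) (radius²-nonNeg m t)
                                   (¬above⇒ w m t (not-injective (∧-conicalʳ _ _ h)))
                                   (λ offset<0 → contradiction 0≤offset (<⇒≱ offset<0))
    where
    0≤offset : 0ℚ ≤ offset w m
    0≤offset = offset-nonNeg {w} {m} (≮ᵇ⇒≥ᴺ {2 ℕ.* w} {m} (not-injective (∧-conicalˡ _ _ h)))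

  difference-square-≤ : ∀ p q → (p - q) * (p - q) ≤ ℕ→ℚ 2 * (p * p) + ℕ→ℚ 2 * (q * q)
  difference-square-≤ p q = begin
    (p - q) * (p - q)                            ≤⟨ p≤p+q ((p - q) * (p - q)) (square-nonNeg (p + q)) ⟩
    (p - q) * (p - q) + (p + q) * (p + q)        ≡⟨ parallelogram p q ⟩
    ℕ→ℚ 2 * (p * p) + ℕ→ℚ 2 * (q * q)            ∎
    where
    open ≤-Reasoning
    parallelogram : ∀ p q → (p - q) * (p - q) + (p + q) * (p + q) ≡ ℕ→ℚ 2 * (p * p) + ℕ→ℚ 2 * (q * q)
    parallelogram = solve-∀ ℚ-ring

  central-width : ∀ {f t} c a → f ℕ.≤ t → central c a f ≡ true → central c a t ≡ true →
    ℕ→ℚ (t ∸ f) * ℕ→ℚ (t ∸ f) ≤ radius² a c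
  central-width {f} {t} c a f≤t central-f central-t = *-cancelˡ-≤ (ℕ→ℚ-mono-< {0} {4} (ℕ.s≤s ℕ.z≤n)) (begin
    ℕ→ℚ 4 * (D * D)                                   ≡⟨ difference (offset f a) D ⟩
    ((o + ℕ→ℚ 2 * D) - o) * ((o + ℕ→ℚ 2 * D) - o)     ≡⟨ cong (λ x → (x - o) * (x - o)) (offset-∸ a f≤t) ⟨
    (offset t a - o) * (offset t a - o)               ≤⟨ difference-square-≤ (offset t a) o ⟩
    ℕ→ℚ 2 * (offset t a * offset t a) + ℕ→ℚ 2 * (o * o)
                                                      ≤⟨ +-mono-≤ (*-monoˡ-≤ (ℕ→ℚ-nonNeg 2) (central⇒ c a t central-t))
                                                                  (*-monoˡ-≤ (ℕ→ℚ-nonNeg 2) (central⇒ c a f central-f)) ⟩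
    ℕ→ℚ 2 * radius² a c + ℕ→ℚ 2 * radius² a c         ≡⟨ twice (radius² a c) ⟩
    ℕ→ℚ 4 * radius² a c                               ∎)
    where
    open ≤-Reasoning
    D = ℕ→ℚ (t ∸ f)
    o = offset f a
    difference : ∀ o D → ℕ→ℚ 4 * (D * D) ≡ ((o + ℕ→ℚ 2 * D) - o) * ((o + ℕ→ℚ 2 * D) - o)
    difference = solve-∀ ℚ-ring
    twice : ∀ K → ℕ→ℚ 2 * K + ℕ→ℚ 2 * K ≡ ℕ→ℚ 4 * K
    twice = solve-∀ ℚ-ring

  middle-width : ∀ {f t} m s → f ℕ.≤ t → middle m s f ≡ true → middle m s t ≡ true →
    ℕ→ℚ (t ∸ f) * ℕ→ℚ (t ∸ f) ≤ s * s * ℕ→ℚ m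
  middle-width {f} {t} m s f≤t middle-f middle-t = *-cancelˡ-≤ (ℕ→ℚ-mono-< {0} {4} (ℕ.s≤s ℕ.z≤n)) (begin
    ℕ→ℚ 4 * (D * D)                 ≡⟨ double D ⟩
    (ℕ→ℚ 2 * D) * (ℕ→ℚ 2 * D)       ≤⟨ square-mono-≤ (*-nonNeg (ℕ→ℚ-nonNeg 2) (ℕ→ℚ-nonNeg (t ∸ f))) 2D≤offset ⟩
    offset t m * offset t m         ≤⟨ proj₂ (middle⇒ m s t middle-t) ⟩
    ℕ→ℚ 4 * s * s * ℕ→ℚ m           ≡⟨ reassoc (ℕ→ℚ 4) s (ℕ→ℚ m) ⟩
    ℕ→ℚ 4 * (s * s * ℕ→ℚ m)         ∎)
    where
    open ≤-Reasoning
    D = ℕ→ℚ (t ∸ f)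
    double : ∀ D → ℕ→ℚ 4 * (D * D) ≡ (ℕ→ℚ 2 * D) * (ℕ→ℚ 2 * D)
    double = solve-∀ ℚ-ring
    reassoc : ∀ f s m → f * s * s * m ≡ f * (s * s * m)
    reassoc = solve-∀ ℚ-ring
    2D≤offset : ℕ→ℚ 2 * D ≤ offset t m
    2D≤offset = begin
      ℕ→ℚ 2 * D                ≤⟨ p≤q+p (ℕ→ℚ 2 * D) (proj₁ (middle⇒ m s f middle-f)) ⟩
      offset f m + ℕ→ℚ 2 * D   ≡⟨ offset-∸ m f≤t ⟨
      offset t m               ∎

module Approximation where

  open import Defs
  open Threshold using (above-mono; belowHalf-mono; central; middle)
  open import Data.Bool using (Bool; true; false; not; _∧_; _∨_; if_then_else_)
  import Data.Bool as Bool
  open import Data.Bool.ListAction using (and)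
  open import Data.Nat as ℕ using (ℕ; _∸_)
  open import Data.Integer using (+_)
  open import Data.Rational as ℚ using (ℚ; _*_)
  open import Data.Fin using (Fin)
  open import Data.Fin.Subset using (Subset; ∁; _∩_; ∣_∣)
  open import Data.List using (List; []; _∷_; allFin; map)
  open import Data.List.Relation.Binary.Sublist.Propositional using (_⊆_; []; _∷_; _∷ʳ_; ⊆-refl)
  open import Data.List.Relation.Binary.Sublist.Propositional.Properties using (filter⁺)
  open import Data.Vec using (Vec; lookup)
  open import Data.Vec.Properties using (lookup⇒[]=; []=⇒lookup)
  import Data.Fin.Subset as Sub
  open import Data.Fin.Subset.Properties using (p⊆q⇒∣p∣≤∣q∣; x∈p∩q⁺; x∈p∩q⁻)
  open import Data.Product using (_,_)
  open import Data.Bool.Properties using (T-≡)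
  open import Function.Bundles using (Equivalence)
  open import Data.Sum using (_⊎_; inj₁; inj₂)
  import Data.Sum as Sum
  open import Function using (_∘_)
  open import Relation.Binary.PropositionalEquality

  -- The case analysis of Defs.fYes, with the value on a unique satisfied term ℓ left as h ℓ.
  dispatch : ∀ {L} (high low : Bool) (h : Fin L → Bool) → List (Fin L) → Bool
  dispatch high low h (_ ∷ _ ∷ _) = true
  dispatch high low h []          = if high then true else false
  dispatch high low h (ℓ ∷ [])    = if high then true else if low then false else h ℓ

  dispatch-high : ∀ {L} {high : Bool} low (h : Fin L → Bool) S → high ≡ true → dispatch high low h S ≡ true
  dispatch-high low h (_ ∷ _ ∷ _) _    = refl
  dispatch-high low h []          refl = refl
  dispatch-high low h (_ ∷ [])    refl = refl

  dispatch-mono : ∀ {L} {high high′ low low′ : Bool} (h : Fin L → Bool) {S S′ : List (Fin L)} →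
    (high ≡ true → high′ ≡ true) → (low ≡ false → low′ ≡ false) → S ⊆ S′ →
    dispatch high low h S ≡ true → dispatch high′ low′ h S′ ≡ true
  dispatch-mono {high = true} h {S′ = S′} hi lo _ _ = dispatch-high _ h S′ (hi refl)
  dispatch-mono {high = false} h hi lo (_ ∷ʳ _ ∷ʳ _) _ = refl
  dispatch-mono {high = false} h hi lo (_ ∷ʳ _ ∷ _)  _ = refl
  dispatch-mono {high = false} h hi lo (_ ∷ _ ∷ʳ _)  _ = refl
  dispatch-mono {high = false} h hi lo (_ ∷ _ ∷ _)   _ = refl
  dispatch-mono {high = false} {high′ = true} h hi lo (refl ∷ []) _ = refl
  dispatch-mono {high = false} {high′ = false} {low = false} h hi lo (refl ∷ []) hℓ rewrite lo refl = hℓ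
  dispatch-mono {high = false} {low = true} h hi lo (refl ∷ []) ()
  dispatch-mono {high = false} h hi lo []        ()
  dispatch-mono {high = false} h hi lo (_ ∷ʳ []) ()

  dispatch-agrees : ∀ {L} high low {h h′ : Fin L → Bool} (P : Bool) → (∀ ℓ → h ℓ ≡ h′ ℓ ⊎ P ≡ true) →
    ∀ S → dispatch high low h S ≡ dispatch high low h′ S ⊎ (P ∧ not low ∧ not high) ≡ true
  dispatch-agrees high  low   P h≈h′ (_ ∷ _ ∷ _) = inj₁ refl
  dispatch-agrees high  low   P h≈h′ []          = inj₁ refl
  dispatch-agrees true  low   P h≈h′ (ℓ ∷ [])    = inj₁ refl
  dispatch-agrees false true  P h≈h′ (ℓ ∷ [])    = inj₁ refl
  dispatch-agrees false false P h≈h′ (ℓ ∷ []) with h≈h′ ℓ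
  ... | inj₁ hℓ≡h′ℓ = inj₁ hℓ≡h′ℓ
  ... | inj₂ refl   = inj₂ refl

  and-mono : ∀ {A : Set} (p q : A → Bool) → (∀ a → p a ≡ true → q a ≡ true) →
    ∀ as → and (map p as) ≡ true → and (map q as) ≡ true
  and-mono p q p⇒q []       _ = refl
  and-mono p q p⇒q (a ∷ as) pas with p a in pa
  ... | true rewrite p⇒q a pa = and-mono p q p⇒q as pas

  ≤ᵛ⇒⊆ : ∀ {n} {x y : Vec Bool n} → x ≤ᵛ y → x Sub.⊆ y
  ≤ᵛ⇒⊆ {y = y} x≤y {i} i∈x = lookup⇒[]= i y (x≤y i ([]=⇒lookup i∈x))

  ∣∩∣-mono : ∀ {n} {x y : Vec Bool n} (C : Subset n) → x ≤ᵛ y → ∣ x ∩ C ∣ ℕ.≤ ∣ y ∩ C ∣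
  ∣∩∣-mono {x = x} {y} C x≤y = p⊆q⇒∣p∣≤∣q∣ {p = x ∩ C} {y ∩ C} λ i∈x∩C →
    let (i∈x , i∈C) = x∈p∩q⁻ x C i∈x∩C in x∈p∩q⁺ (≤ᵛ⇒⊆ x≤y i∈x , i∈C)

  termSat-mono : ∀ {n k} {x y : Vec Bool n} (t : Fin k → Fin n) → x ≤ᵛ y →
    termSat x t ≡ true → termSat y t ≡ true
  termSat-mono {k = k} {x} {y} t x≤y = and-mono (lookup x ∘ t) (lookup y ∘ t) (λ j → x≤y (t j)) (allFin k)

  satTerms-mono : ∀ {n k L} {x y : Vec Bool n} (T : Fin L → Fin k → Fin n) → x ≤ᵛ y → satTerms x T ⊆ satTerms y T
  satTerms-mono {x = x} {y} T x≤y =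
    filter⁺ (Bool.T? ∘ λ ℓ → termSat x (T ℓ)) (Bool.T? ∘ λ ℓ → termSat y (T ℓ)) step (⊆-refl {x = allFin _})
    where
    step : ∀ {ℓ ℓ′} → ℓ ≡ ℓ′ → Bool.T (termSat x (T ℓ)) → Bool.T (termSat y (T ℓ′))
    step refl = Equivalence.from T-≡ ∘ termSat-mono {x = x} {y} (T _) x≤y ∘ Equivalence.to T-≡

  hPlus≡⊎central : ∀ c₁ a β w → hPlus c₁ a β w ≡ β ⊎ central c₁ a w ≡ true
  hPlus≡⊎central c₁ a false w = inj₁ refl
  hPlus≡⊎central c₁ a true  w = ≡true⊎not≡true (above w a c₁ ∨ below w a c₁)
    where
    ≡true⊎not≡true : ∀ b → b ≡ true ⊎ not b ≡ true
    ≡true⊎not≡true true  = inj₁ refl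
    ≡true⊎not≡true false = inj₂ refl

  module _ {n k L} (ε : ℚ) (A : Subset n) (T : Fin L → Fin k → Fin n) where

    private
      m : ℕ
      m = n ∸ ∣ A ∣

      t : ℚ
      t = ε * (+ 1 ℚ./ 20)

      low : Vec Bool n → Bool
      low x = 2 ℕ.* ∣ x ∩ ∁ A ∣ ℕ.<ᵇ m

    -- Opaque: otherwise with-abstraction over fYes normalises this rational test, which is very slow.
    opaque
      high : Vec Bool n → Bool
      high x = above ∣ x ∩ ∁ A ∣ m t

      above≡high : ∀ x → above ∣ x ∩ ∁ A ∣ m t ≡ high x
      above≡high x = refl

      high-mono : ∀ {x y} → x ≤ᵛ y → high x ≡ true → high y ≡ true
      high-mono {x} {y} x≤y = above-mono m t (∣∩∣-mono {x = x} {y} (∁ A) x≤y)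

    gYes : (b : Fin L → Bool) → Vec Bool n → Bool
    gYes b x = dispatch (high x) (low x) b (satTerms x T)

    gYes-monotone : ∀ b → Monotone (gYes b)
    gYes-monotone b x y x≤y = dispatch-mono b (high-mono x≤y)
      (belowHalf-mono m (∣∩∣-mono {x = x} {y} (∁ A) x≤y))
      (satTerms-mono {x = x} {y} T x≤y)

    fYes≡dispatch : ∀ c₁ b x →
      fYes c₁ ε A T b x ≡ dispatch (high x) (low x) (λ ℓ → hPlus c₁ ∣ A ∣ (b ℓ) (∣ x ∩ A ∣)) (satTerms x T)
    fYes≡dispatch c₁ b x with satTerms x T
    ... | _ ∷ _ ∷ _ = refl
    ... | []        = cong (if_then true else false) (above≡high x)
    ... | ℓ ∷ []    =
      cong (if_then true else (if low x then false else hPlus c₁ ∣ A ∣ (b ℓ) (∣ x ∩ A ∣))) (above≡high x)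

    fYes≡gYes⊎band : ∀ c₁ b x →
      fYes c₁ ε A T b x ≡ gYes b x ⊎ (central c₁ ∣ A ∣ (∣ x ∩ A ∣) ∧ middle m t (∣ x ∩ ∁ A ∣)) ≡ true
    fYes≡gYes⊎band c₁ b x = Sum.map (trans (fYes≡dispatch c₁ b x))
      (subst (λ h → (central c₁ ∣ A ∣ (∣ x ∩ A ∣) ∧ not (low x) ∧ not h) ≡ true) (sym (above≡high x)))
      (dispatch-agrees (high x) (low x) (central c₁ ∣ A ∣ (∣ x ∩ A ∣))
                       (λ ℓ → hPlus≡⊎central c₁ ∣ A ∣ (b ℓ) (∣ x ∩ A ∣)) (satTerms x T))

module Estimate where

  open import Defs using (ℕ→ℚ; tenth)
  open Rational
  open Counting using (count; count≡0⊎spanned)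
  open Threshold using (radius²)
  open import Data.Bool using (true)
  open import Data.Nat as ℕ using (ℕ; suc; _∸_)
  import Data.Nat.Properties as ℕ
  open import Data.Nat.Tactic.RingSolver using () renaming (solve-∀ to ℕ-solve-∀)
  open import Data.Integer using (+_)
  open import Data.Rational as ℚ using (ℚ; _+_; _*_; _-_; -_; _≤_; _<_; 0ℚ; 1ℚ; 1/_; positive)
  open import Data.Rational.Properties
    using (≤-trans; ≤-reflexive; <-≤-trans; <⇒≤; ≤ᵇ⇒≤; positive⁻¹; pos⇒nonZero; neg-antimono-≤;
           +-inverseʳ; +-monoˡ-≤; +-monoʳ-≤; +-monoʳ-<; *-identityʳ; *-inverseʳ; module ≤-Reasoning)
  open import Data.Product using (_,_)
  open import Data.Sum using (inj₁; inj₂)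
  open import Relation.Binary.PropositionalEquality
  open import Relation.Nullary using (yes; no)
  open import Tactic.RingSolver using (solve-∀)

  c<1+a : ∀ n a {ε c} → 0ℚ < ε → ε < 1ℚ → c * c ≤ ε * ε * ℕ→ℚ n → ℕ→ℚ n < ℕ→ℚ (suc a ℕ.* suc a) * ε * ε →
    c < ℕ→ℚ (suc a)
  c<1+a n a {ε} {c} 0<ε ε<1 c²≤ε²n n<[1+a]²ε² = square-cancel-< (ℕ→ℚ-nonNeg (suc a)) (begin-strict
    c * c                                   ≤⟨ c²≤ε²n ⟩
    ε * ε * ℕ→ℚ n                           <⟨ *-monoˡ-< (*-pos 0<ε 0<ε) n<[1+a]²ε² ⟩
    ε * ε * (ℕ→ℚ (suc a ℕ.* suc a) * ε * ε) ≡⟨ cong (λ x → ε * ε * (x * ε * ε)) (ℕ→ℚ-* (suc a) (suc a)) ⟩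
    ε * ε * (s * s * ε * ε)                 ≡⟨ regroup ε s ⟩
    s * s * (ε * ε * (ε * ε))               ≤⟨ *-monoˡ-≤ (square-nonNeg s) (square-mono-≤ (square-nonNeg ε) ε²≤1) ⟩
    s * s * (1ℚ * 1ℚ)                       ≡⟨ *-identityʳ (s * s) ⟩
    s * s                                   ∎)
    where
    open ≤-Reasoning
    s = ℕ→ℚ (suc a)
    ε²≤1 : ε * ε ≤ 1ℚ
    ε²≤1 = square-mono-≤ (<⇒≤ 0<ε) (<⇒≤ ε<1)
    regroup : ∀ ε s → ε * ε * (s * s * ε * ε) ≡ s * s * (ε * ε * (ε * ε))
    regroup = solve-∀ ℚ-ring

  a*c≤n : ∀ n a {ε c} → 0ℚ ≤ c → c * c ≤ ε * ε * ℕ→ℚ n → ℕ→ℚ (a ℕ.* a) * ε * ε ≤ ℕ→ℚ n →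
    ℕ→ℚ a * c ≤ ℕ→ℚ n
  a*c≤n n a {ε} {c} 0≤c c²≤ε²n a²ε²≤n = square-cancel-≤ (ℕ→ℚ-nonNeg n) (begin
    x * c * (x * c)                 ≡⟨ regroup x c ⟩
    (x * x) * (c * c)               ≤⟨ *-monoˡ-≤ (square-nonNeg x) c²≤ε²n ⟩
    (x * x) * (ε * ε * ℕ→ℚ n)        ≡⟨ reassoc x ε (ℕ→ℚ n) ⟩
    (x * x * ε * ε) * ℕ→ℚ n          ≡⟨ cong (λ y → y * ε * ε * ℕ→ℚ n) (ℕ→ℚ-* a a) ⟨
    (ℕ→ℚ (a ℕ.* a) * ε * ε) * ℕ→ℚ n  ≤⟨ *-monoʳ-≤ (ℕ→ℚ-nonNeg n) a²ε²≤n ⟩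
    ℕ→ℚ n * ℕ→ℚ n                   ∎)
    where
    open ≤-Reasoning
    x = ℕ→ℚ a
    regroup : ∀ x c → x * c * (x * c) ≡ (x * x) * (c * c)
    regroup = solve-∀ ℚ-ring
    reassoc : ∀ x ε n → (x * x) * (ε * ε * n) ≡ (x * x * ε * ε) * n
    reassoc = solve-∀ ℚ-ring

  c[c-1]≤ε²[n∸a] : ∀ n a {ε c} → 1ℚ ≤ c → c * c ≤ ε * ε * ℕ→ℚ n → ℕ→ℚ a * c ≤ ℕ→ℚ n → a ℕ.≤ n →
    c * (c - 1ℚ) ≤ ε * ε * ℕ→ℚ (n ∸ a)
  c[c-1]≤ε²[n∸a] n a {ε} {c} 1≤c c²≤ε²n ac≤n a≤n = *-cancelʳ-≤ 0<c (begin
    c * (c - 1ℚ) * c                     ≡⟨ regroup c ⟩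
    c * c * (c - 1ℚ)                     ≤⟨ *-monoʳ-≤ 0≤c-1 c²≤ε²n ⟩
    e * ℕ→ℚ n * (c - 1ℚ)                 ≡⟨ expand e (ℕ→ℚ n) c ⟩
    e * ℕ→ℚ n * c - e * ℕ→ℚ n            ≤⟨ +-monoʳ-≤ (e * ℕ→ℚ n * c) (neg-antimono-≤ (*-monoˡ-≤ 0≤e ac≤n)) ⟩
    e * ℕ→ℚ n * c - e * (ℕ→ℚ a * c)      ≡⟨ collect e (ℕ→ℚ n) (ℕ→ℚ a) c ⟩
    e * (ℕ→ℚ n - ℕ→ℚ a) * c              ≡⟨ cong (λ y → e * y * c) (ℕ→ℚ-∸ n a a≤n) ⟨
    e * ℕ→ℚ (n ∸ a) * c                  ∎)
    where
    open ≤-Reasoning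
    e = ε * ε
    0<c : 0ℚ < c
    0<c = <-≤-trans (positive⁻¹ 1ℚ) 1≤c
    0≤e : 0ℚ ≤ e
    0≤e = square-nonNeg ε
    0≤c-1 : 0ℚ ≤ c - 1ℚ
    0≤c-1 = ≤-trans (≤-reflexive (sym (+-inverseʳ 1ℚ))) (+-monoˡ-≤ (- 1ℚ) 1≤c)
    regroup : ∀ c → c * (c - 1ℚ) * c ≡ c * c * (c - 1ℚ)
    regroup = solve-∀ ℚ-ring
    expand : ∀ e n c → e * n * (c - 1ℚ) ≡ e * n * c - e * n
    expand = solve-∀ ℚ-ring
    collect : ∀ e n a c → e * n * c - e * (a * c) ≡ e * (n - a) * c
    collect = solve-∀ ℚ-ring

  insert-inverse² : ∀ f h c i → c * i ≡ 1ℚ → f * h ≡ f * c * c * (h * (i * i))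
  insert-inverse² f h c i ci≡1 = begin
    f * h                        ≡⟨ *-identityʳ (f * h) ⟨
    f * h * (1ℚ * 1ℚ)            ≡⟨ cong (λ z → f * h * (z * z)) ci≡1 ⟨
    f * h * (c * i * (c * i))    ≡⟨ regroup f h c i ⟩
    f * c * c * (h * (i * i))    ∎
    where
    open ≡-Reasoning
    regroup : ∀ f h c i → f * h * (c * i * (c * i)) ≡ f * c * c * (h * (i * i))
    regroup = solve-∀ ℚ-ring

  module _ (c₁ : ℚ) (0<c₁ : 0ℚ < c₁) where

    private instance
      c₁≢0 : ℚ.NonZero c₁
      c₁≢0 = pos⇒nonZero c₁ {{positive 0<c₁}}

    c₀ : ℚ
    c₀ = ℕ→ℚ 401 + ℕ→ℚ 100 * (1/ c₁ * 1/ c₁)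

    401≤c₀ : ℕ→ℚ 401 ≤ c₀
    401≤c₀ = p≤p+q (ℕ→ℚ 401) (*-nonNeg (ℕ→ℚ-nonNeg 100) (square-nonNeg (1/ c₁)))

    0<c₀ : 0ℚ < c₀
    0<c₀ = <-≤-trans (ℕ→ℚ-mono-< {0} {401} (ℕ.s≤s ℕ.z≤n)) 401≤c₀

    400≤radius² : ∀ {a} → c₀ < ℕ→ℚ (suc a) → ℕ→ℚ 400 ≤ radius² a c₁
    400≤radius² {a} c₀<1+a = begin
      ℕ→ℚ 400                                      ≡⟨ ℕ→ℚ-* 4 100 ⟩
      ℕ→ℚ 4 * ℕ→ℚ 100                              ≡⟨ insert-inverse² (ℕ→ℚ 4) (ℕ→ℚ 100) c₁ (1/ c₁) (*-inverseʳ c₁) ⟩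
      ℕ→ℚ 4 * c₁ * c₁ * (ℕ→ℚ 100 * (1/ c₁ * 1/ c₁)) ≤⟨ *-monoˡ-≤ (*-nonNeg (*-nonNeg (ℕ→ℚ-nonNeg 4) (<⇒≤ 0<c₁)) (<⇒≤ 0<c₁)) u≤a ⟩
      ℕ→ℚ 4 * c₁ * c₁ * ℕ→ℚ a                      ∎
      where
      open ≤-Reasoning
      u = ℕ→ℚ 100 * (1/ c₁ * 1/ c₁)
      u≤a : u ≤ ℕ→ℚ a
      u≤a = <⇒≤ (begin-strict
        u                          ≤⟨ p≤q+p u (ℕ→ℚ-nonNeg 400) ⟩
        ℕ→ℚ 400 + u                ≡⟨ shift u ⟩
        - 1ℚ + (ℕ→ℚ 401 + u)       <⟨ +-monoʳ-< (- 1ℚ) c₀<1+a ⟩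
        - 1ℚ + ℕ→ℚ (suc a)         ≡⟨ cong (λ x → - 1ℚ + x) (ℕ→ℚ-+ 1 a) ⟩
        - 1ℚ + (1ℚ + ℕ→ℚ a)        ≡⟨ unshift (ℕ→ℚ a) ⟩
        ℕ→ℚ a                      ∎)
        where
        shift : ∀ u → ℕ→ℚ 400 + u ≡ - 1ℚ + (ℕ→ℚ 401 + u)
        shift = solve-∀ ℚ-ring
        unshift : ∀ x → - 1ℚ + (1ℚ + x) ≡ x
        unshift = solve-∀ ℚ-ring

  400≤[ε/20]²m : ∀ m {c ε} → ℕ→ℚ 401 ≤ c → c * (c - 1ℚ) ≤ ε * ε * ℕ→ℚ m →
    ℕ→ℚ 400 ≤ (ε * (+ 1 ℚ./ 20)) * (ε * (+ 1 ℚ./ 20)) * ℕ→ℚ m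
  400≤[ε/20]²m m {c} {ε} 401≤c c[c-1]≤ε²m = begin
    ℕ→ℚ 400                                   ≤⟨ ≤ᵇ⇒≤ _ ⟩
    ℕ→ℚ 401 * ℕ→ℚ 400 * (t * t)               ≤⟨ *-monoʳ-≤ (square-nonNeg t) (*-mono-≤ (ℕ→ℚ-nonNeg 401) (ℕ→ℚ-nonNeg 400) 401≤c 400≤c-1) ⟩
    c * (c - 1ℚ) * (t * t)                    ≤⟨ *-monoʳ-≤ (square-nonNeg t) c[c-1]≤ε²m ⟩
    ε * ε * ℕ→ℚ m * (t * t)                   ≡⟨ regroup ε (ℕ→ℚ m) t ⟩
    (ε * t) * (ε * t) * ℕ→ℚ m                 ∎
    where
    open ≤-Reasoning
    t = + 1 ℚ./ 20
    400≤c-1 : ℕ→ℚ 400 ≤ c - 1ℚ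
    400≤c-1 = ≤-trans (≤-reflexive (ℕ→ℚ-∸ 401 1 (ℕ.s≤s ℕ.z≤n))) (+-monoˡ-≤ (- 1ℚ) 401≤c)
    regroup : ∀ ε m t → ε * ε * m * (t * t) ≡ (ε * t) * (ε * t) * m
    regroup = solve-∀ ℚ-ring

  succ-square-≤ : ∀ D K → ℕ→ℚ D * ℕ→ℚ D ≤ K → ℕ→ℚ 400 ≤ K →
    ℕ→ℚ 400 * (ℕ→ℚ (suc D) * ℕ→ℚ (suc D)) ≤ ℕ→ℚ 441 * K
  succ-square-≤ D K D²≤K 400≤K with 20 ℕ.≤? D
  ... | yes 20≤D = begin
    ℕ→ℚ 400 * (ℕ→ℚ (suc D) * ℕ→ℚ (suc D))  ≡⟨ cast 400 (suc D) ⟨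
    ℕ→ℚ (400 ℕ.* (suc D ℕ.* suc D))         ≤⟨ ℕ→ℚ-mono-≤ {400 ℕ.* (suc D ℕ.* suc D)} {441 ℕ.* (D ℕ.* D)} 400[1+D]²≤441D² ⟩
    ℕ→ℚ (441 ℕ.* (D ℕ.* D))                 ≡⟨ cast 441 D ⟩
    ℕ→ℚ 441 * (ℕ→ℚ D * ℕ→ℚ D)               ≤⟨ *-monoˡ-≤ (ℕ→ℚ-nonNeg 441) D²≤K ⟩
    ℕ→ℚ 441 * K                             ∎
    where
    open ≤-Reasoning
    cast : ∀ k d → ℕ→ℚ (k ℕ.* (d ℕ.* d)) ≡ ℕ→ℚ k * (ℕ→ℚ d * ℕ→ℚ d)
    cast k d = trans (ℕ→ℚ-* k (d ℕ.* d)) (cong (ℕ→ℚ k *_) (ℕ→ℚ-* d d))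
    expand20 : ∀ D → 20 ℕ.* D ℕ.+ 20 ≡ 20 ℕ.* suc D
    expand20 = ℕ-solve-∀
    expand21 : ∀ D → 20 ℕ.* D ℕ.+ D ≡ 21 ℕ.* D
    expand21 = ℕ-solve-∀
    square20 : ∀ D → 20 ℕ.* suc D ℕ.* (20 ℕ.* suc D) ≡ 400 ℕ.* (suc D ℕ.* suc D)
    square20 = ℕ-solve-∀
    square21 : ∀ D → 21 ℕ.* D ℕ.* (21 ℕ.* D) ≡ 441 ℕ.* (D ℕ.* D)
    square21 = ℕ-solve-∀
    20[1+D]≤21D : 20 ℕ.* suc D ℕ.≤ 21 ℕ.* D
    20[1+D]≤21D = subst₂ ℕ._≤_ (expand20 D) (expand21 D) (ℕ.+-monoʳ-≤ (20 ℕ.* D) 20≤D)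
    400[1+D]²≤441D² : 400 ℕ.* (suc D ℕ.* suc D) ℕ.≤ 441 ℕ.* (D ℕ.* D)
    400[1+D]²≤441D² = subst₂ ℕ._≤_ (square20 D) (square21 D) (ℕ.*-mono-≤ 20[1+D]≤21D 20[1+D]≤21D)
  ... | no  D≱20 = begin
    ℕ→ℚ 400 * (ℕ→ℚ (suc D) * ℕ→ℚ (suc D))  ≡⟨ cong (ℕ→ℚ 400 *_) (ℕ→ℚ-* (suc D) (suc D)) ⟨
    ℕ→ℚ 400 * ℕ→ℚ (suc D ℕ.* suc D)         ≤⟨ *-monoˡ-≤ (ℕ→ℚ-nonNeg 400) (≤-trans (ℕ→ℚ-mono-≤ {suc D ℕ.* suc D} {400} [1+D]²≤400) 400≤K) ⟩
    ℕ→ℚ 400 * K                             ≤⟨ *-monoʳ-≤ (≤-trans (ℕ→ℚ-nonNeg 400) 400≤K) (ℕ→ℚ-mono-≤ {400} {441} (ℕ.m≤m+n 400 41)) ⟩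
    ℕ→ℚ 441 * K                             ∎
    where
    open ≤-Reasoning
    [1+D]²≤400 : suc D ℕ.* suc D ℕ.≤ 400
    [1+D]²≤400 = ℕ.*-mono-≤ (ℕ.≰⇒> D≱20) (ℕ.≰⇒> D≱20)

  count-bound : ∀ N Q K → 0ℚ ≤ K → ℕ→ℚ 400 ≤ K →
    (∀ {f t} → f ℕ.≤ t → Q f ≡ true → Q t ≡ true → ℕ→ℚ (t ∸ f) * ℕ→ℚ (t ∸ f) ≤ K) →
    ℕ→ℚ 400 * (ℕ→ℚ (count N Q) * ℕ→ℚ (count N Q)) ≤ ℕ→ℚ 441 * K
  count-bound N Q K 0≤K 400≤K width with count N Q | count≡0⊎spanned N Q
  ... | _ | inj₁ refl = *-nonNeg (ℕ→ℚ-nonNeg 441) 0≤K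
  ... | c | inj₂ (f , t , Qf , Qt , f≤t , c≤1+D) =
    ≤-trans (*-monoˡ-≤ (ℕ→ℚ-nonNeg 400) (square-mono-≤ (ℕ→ℚ-nonNeg c) (ℕ→ℚ-mono-≤ {c} {suc (t ∸ f)} c≤1+D)))
            (succ-square-≤ (t ∸ f) K (width f≤t Qf Qt) 400≤K)

  final-estimate : ∀ {α β ρ σ a m c e P Pa Pm} →
    0ℚ ≤ α → 0ℚ ≤ β → 0ℚ < a → 0ℚ < m → 0ℚ ≤ c → 0ℚ ≤ e → 0ℚ ≤ P →
    α * α * (ℕ→ℚ 3 * a) ≤ ℕ→ℚ 2 * Pa → β * β * (ℕ→ℚ 3 * m) ≤ ℕ→ℚ 2 * Pm → Pa * Pm ≡ P * P →
    ℕ→ℚ 400 * (ρ * ρ) ≤ ℕ→ℚ 441 * (ℕ→ℚ 4 * c * c * a) →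
    ℕ→ℚ 400 * (σ * σ) ≤ ℕ→ℚ 441 * ((e * (+ 1 ℚ./ 20)) * (e * (+ 1 ℚ./ 20)) * m) →
    α * ρ * (β * σ) ≤ tenth * c * e * P
  final-estimate {α} {β} {ρ} {σ} {a} {m} {c} {e} {P} {Pa} {Pm} 0≤α 0≤β 0<a 0<m 0≤c 0≤e 0≤P α² β² PaPm ρ² σ² =
    square-cancel-≤ 0≤bound (*-cancelʳ-≤ 0<Z (begin
      α * ρ * (β * σ) * (α * ρ * (β * σ)) * Z
                                   ≡⟨ regroup α β ρ σ a m three k400 ⟩
      α * α * (three * a) * (β * β * (three * m)) * (k400 * (ρ * ρ) * (k400 * (σ * σ)))
                                   ≤⟨ *-mono-≤ (*-nonNeg (weighted-nonNeg 0≤α 0<a) (weighted-nonNeg 0≤β 0<m))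
                                               (*-nonNeg (scaled-nonNeg ρ) (scaled-nonNeg σ))
                                               (*-mono-≤ (weighted-nonNeg 0≤α 0<a) (weighted-nonNeg 0≤β 0<m) α² β²)
                                               (*-mono-≤ (scaled-nonNeg ρ) (scaled-nonNeg σ) ρ² σ²) ⟩
      two * Pa * (two * Pm) * (k441 * (four * c * c * a) * (k441 * ((e * t) * (e * t) * m)))
                                   ≡⟨ collect two four k441 t Pa Pm c e a m ⟩
      κ * (c * c * (e * e) * (Pa * Pm) * (a * m))
                                   ≡⟨ cong (λ x → κ * (c * c * (e * e) * x * (a * m))) PaPm ⟩
      κ * (c * c * (e * e) * (P * P) * (a * m))
                                   ≤⟨ *-monoʳ-≤ 0≤rest κ≤tenth²z ⟩
      tenth * tenth * z * (c * c * (e * e) * (P * P) * (a * m))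
                                   ≡⟨ spread tenth z c e P a m ⟩
      tenth * c * e * P * (tenth * c * e * P) * Z
                                   ∎))
    where
    open ≤-Reasoning
    two = ℕ→ℚ 2
    three = ℕ→ℚ 3
    four = ℕ→ℚ 4
    k400 = ℕ→ℚ 400
    k441 = ℕ→ℚ 441
    t = + 1 ℚ./ 20
    κ = two * two * k441 * k441 * four * (t * t)
    z = three * k400 * (three * k400)
    Z = z * (a * m)
    -- 16·441²/20² ≈ 7779 ≤ 14400 = (3·400/10)²: the slack in the constant 0.1.
    κ≤tenth²z : κ ≤ tenth * tenth * z
    κ≤tenth²z = ≤ᵇ⇒≤ {κ} {tenth * tenth * z} _
    0≤tenth : 0ℚ ≤ tenth
    0≤tenth = ≤ᵇ⇒≤ {0ℚ} {tenth} _
    0<Z : 0ℚ < Z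
    0<Z = *-pos (positive⁻¹ z) (*-pos 0<a 0<m)
    0≤bound : 0ℚ ≤ tenth * c * e * P
    0≤bound = *-nonNeg (*-nonNeg (*-nonNeg 0≤tenth 0≤c) 0≤e) 0≤P
    0≤rest : 0ℚ ≤ c * c * (e * e) * (P * P) * (a * m)
    0≤rest = *-nonNeg (*-nonNeg (*-nonNeg (square-nonNeg c) (square-nonNeg e)) (square-nonNeg P))
                      (*-nonNeg (<⇒≤ 0<a) (<⇒≤ 0<m))
    weighted-nonNeg : ∀ {α a} → 0ℚ ≤ α → 0ℚ < a → 0ℚ ≤ α * α * (three * a)
    weighted-nonNeg {α} 0≤α 0<a = *-nonNeg (square-nonNeg α) (*-nonNeg (ℕ→ℚ-nonNeg 3) (<⇒≤ 0<a))
    scaled-nonNeg : ∀ σ → 0ℚ ≤ k400 * (σ * σ)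
    scaled-nonNeg σ = *-nonNeg (ℕ→ℚ-nonNeg 400) (square-nonNeg σ)
    regroup : ∀ α β ρ σ a m three k400 →
              α * ρ * (β * σ) * (α * ρ * (β * σ)) * (three * k400 * (three * k400) * (a * m))
              ≡ α * α * (three * a) * (β * β * (three * m)) * (k400 * (ρ * ρ) * (k400 * (σ * σ)))
    regroup = solve-∀ ℚ-ring
    collect : ∀ two four k441 t Pa Pm c e a m →
              two * Pa * (two * Pm) * (k441 * (four * c * c * a) * (k441 * ((e * t) * (e * t) * m)))
              ≡ two * two * k441 * k441 * four * (t * t) * (c * c * (e * e) * (Pa * Pm) * (a * m))
    collect = solve-∀ ℚ-ring
    spread : ∀ tenth z c e P a m → tenth * tenth * z * (c * c * (e * e) * (P * P) * (a * m))
             ≡ tenth * c * e * P * (tenth * c * e * P) * (z * (a * m))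
    spread = solve-∀ ℚ-ring

open import Defs
open Rational
open Binomial using (C-max-bound)
open Counting using (count; weightCount; weightCount-≤; #cube; #cube-weights; disagree-≤)
open Threshold using (central; middle; radius²; radius²-nonNeg; central-width; middle-width)
open Approximation using (gYes; gYes-monotone; fYes≡gYes⊎band)
open Estimate
  using (c₀; 401≤c₀; 0<c₀; 400≤radius²; c<1+a; a*c≤n; c[c-1]≤ε²[n∸a]; 400≤[ε/20]²m; count-bound; final-estimate)
open import Data.Bool using (Bool)
open import Data.Nat as ℕ using (ℕ; _∸_; _^_; _/_)
open import Data.Rational as ℚ using (ℚ; _≤_; _<_; _*_; 0ℚ; 1ℚ)
open import Data.Fin using (Fin)
open import Data.Fin.Subset using (Subset; ∁; ∣_∣; _∈_)
open import Data.Product using (Σ; _×_)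
open import Relation.Binary.PropositionalEquality using (_≡_)
open import Data.Bool using (_∧_)
open import Data.Nat using (suc)
import Data.Nat.Properties as ℕ
open import Data.Integer using (+_)
open import Data.Rational.Properties
  using (≤-trans; <-≤-trans; ≤-<-trans; <⇒≤; ≤-reflexive; *-identityʳ; *-zeroʳ; *-cancelˡ-<-nonNeg; positive⁻¹; module ≤-Reasoning)
open import Data.Fin.Subset using (_∩_)
open import Data.Fin.Subset.Properties using (∣∁p∣≡n∸∣p∣)
open import Data.Vec using (Vec)
open import Data.Product using (_,_; proj₁; proj₂)
open import Relation.Binary.PropositionalEquality using (sym; trans; cong; cong₂; subst)

4^n≡2^n*2^n : ∀ n → 4 ^ n ≡ 2 ^ n ℕ.* 2 ^ n
4^n≡2^n*2^n n = trans (ℕ.^-*-assoc 2 2 n)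
                      (trans (cong (2 ^_) (cong (n ℕ.+_) (ℕ.+-identityʳ n))) (ℕ.^-distribˡ-+-* 2 n n))

binomial-bound-ℚ : ∀ {M a} → M ℕ.* M ℕ.* (3 ℕ.* a ℕ.+ 2) ℕ.≤ 2 ℕ.* 4 ^ a →
  ℕ→ℚ M * ℕ→ℚ M * (ℕ→ℚ 3 * ℕ→ℚ a) ≤ ℕ→ℚ 2 * ℕ→ℚ (4 ^ a)
binomial-bound-ℚ {M} {a} M²[3a+2]≤ = begin
  ℕ→ℚ M * ℕ→ℚ M * (ℕ→ℚ 3 * ℕ→ℚ a)  ≡⟨ cong₂ _*_ (ℕ→ℚ-* M M) (ℕ→ℚ-* 3 a) ⟨
  ℕ→ℚ (M ℕ.* M) * ℕ→ℚ (3 ℕ.* a)     ≡⟨ ℕ→ℚ-* (M ℕ.* M) (3 ℕ.* a) ⟨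
  ℕ→ℚ (M ℕ.* M ℕ.* (3 ℕ.* a))       ≤⟨ ℕ→ℚ-mono-≤ {M ℕ.* M ℕ.* (3 ℕ.* a)} {2 ℕ.* 4 ^ a}
                                          (ℕ.≤-trans (ℕ.*-monoʳ-≤ (M ℕ.* M) (ℕ.m≤m+n (3 ℕ.* a) 2)) M²[3a+2]≤) ⟩
  ℕ→ℚ (2 ℕ.* 4 ^ a)                 ≡⟨ ℕ→ℚ-* 2 (4 ^ a) ⟩
  ℕ→ℚ 2 * ℕ→ℚ (4 ^ a)               ∎
  where open ≤-Reasoning

disagree≤weightCounts : ∀ {n k L} c₁ ε (A : Subset n) (T : Fin L → Fin k → Fin n) b →
  disagree (fYes c₁ ε A T b) (gYes ε A T b)
    ℕ.≤ weightCount (∣ A ∣) (central c₁ (∣ A ∣)) ℕ.* weightCount (n ∸ ∣ A ∣) (middle (n ∸ ∣ A ∣) (ε * (+ 1 ℚ./ 20)))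
disagree≤weightCounts {n} c₁ ε A T b = begin
  disagree (fYes c₁ ε A T b) (gYes ε A T b)                ≤⟨ disagree-≤ (fYes c₁ ε A T b) (gYes ε A T b) band
                                                                         (fYes≡gYes⊎band ε A T c₁ b) ⟩
  #cube band                                               ≡⟨ #cube-weights A QA QC ⟩
  weightCount (∣ A ∣) QA ℕ.* weightCount (∣ ∁ A ∣) QC         ≡⟨ cong (λ m → weightCount (∣ A ∣) QA ℕ.* weightCount m QC) (∣∁p∣≡n∸∣p∣ A) ⟩
  weightCount (∣ A ∣) QA ℕ.* weightCount (n ∸ ∣ A ∣) QC       ∎
  where
  open ℕ.≤-Reasoning
  QA QC : ℕ → Bool
  QA = central c₁ (∣ A ∣)
  QC = middle (n ∸ ∣ A ∣) (ε * (+ 1 ℚ./ 20))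
  band : Vec Bool n → Bool
  band x = QA (∣ x ∩ A ∣) ∧ QC (∣ x ∩ ∁ A ∣)

module _ (c₁ : ℚ) (0<c₁ : 0ℚ < c₁) {n : ℕ} {ε : ℚ} (0<ε : 0ℚ < ε) (ε<1 : ε < 1ℚ)
         (c₀²≤ε²n : c₀ c₁ 0<c₁ * c₀ c₁ 0<c₁ ≤ ε * ε * ℕ→ℚ n) (A : Subset n) (floor : IsFloorSqrtDiv n ε ∣ A ∣) where

  private
    a = ∣ A ∣
    m = n ∸ a
    c = c₀ c₁ 0<c₁
    t = ε * (+ 1 ℚ./ 20)
    1≤c : 1ℚ ≤ c
    1≤c = ≤-trans (ℕ→ℚ-mono-≤ {1} {401} (ℕ.s≤s ℕ.z≤n)) (401≤c₀ c₁ 0<c₁)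
    ac≤n : ℕ→ℚ a * c ≤ ℕ→ℚ n
    ac≤n = a*c≤n n a (<⇒≤ (0<c₀ c₁ 0<c₁)) c₀²≤ε²n (proj₁ floor)

  c₀<1+a : c < ℕ→ℚ (suc a)
  c₀<1+a = c<1+a n a 0<ε ε<1 c₀²≤ε²n (proj₂ floor)

  a≤n : a ℕ.≤ n
  a≤n = ℕ→ℚ-cancel-≤ {a} {n}
    (≤-trans (≤-reflexive (sym (*-identityʳ (ℕ→ℚ a)))) (≤-trans (*-monoˡ-≤ (ℕ→ℚ-nonNeg a) 1≤c) ac≤n))

  0<a : 0ℚ < ℕ→ℚ a
  0<a = ℕ→ℚ-mono-< {0} {a} (ℕ.≤-pred (ℕ→ℚ-cancel-< {1} {suc a} (≤-<-trans 1≤c c₀<1+a)))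

  400≤t²m : ℕ→ℚ 400 ≤ t * t * ℕ→ℚ m
  400≤t²m = 400≤[ε/20]²m m {ε = ε} (401≤c₀ c₁ 0<c₁) (c[c-1]≤ε²[n∸a] n a {ε} 1≤c c₀²≤ε²n ac≤n a≤n)

  0<m : 0ℚ < ℕ→ℚ m
  0<m = *-cancelˡ-<-nonNeg (t * t) {{ℚ.nonNegative (square-nonNeg t)}}
    (<-≤-trans (≤-<-trans (≤-reflexive (*-zeroʳ (t * t))) (positive⁻¹ (ℕ→ℚ 400))) 400≤t²m)

  private
    Ma = proj₁ (C-max-bound a)
    Mm = proj₁ (C-max-bound m)
    cA = count (suc a) (central c₁ a)
    cC = count (suc m) (middle m t)

  Ma-bound : ℕ→ℚ Ma * ℕ→ℚ Ma * (ℕ→ℚ 3 * ℕ→ℚ a) ≤ ℕ→ℚ 2 * ℕ→ℚ (4 ^ a)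
  Ma-bound = binomial-bound-ℚ {Ma} {a} (proj₂ (proj₂ (C-max-bound a)))

  Mm-bound : ℕ→ℚ Mm * ℕ→ℚ Mm * (ℕ→ℚ 3 * ℕ→ℚ m) ≤ ℕ→ℚ 2 * ℕ→ℚ (4 ^ m)
  Mm-bound = binomial-bound-ℚ {Mm} {m} (proj₂ (proj₂ (C-max-bound m)))

  central-count : ℕ→ℚ 400 * (ℕ→ℚ cA * ℕ→ℚ cA) ≤ ℕ→ℚ 441 * radius² a c₁
  central-count = count-bound (suc a) (central c₁ a) (radius² a c₁) (radius²-nonNeg a c₁)
                              (400≤radius² c₁ 0<c₁ {a} c₀<1+a) (central-width c₁ a)

  middle-count : ℕ→ℚ 400 * (ℕ→ℚ cC * ℕ→ℚ cC) ≤ ℕ→ℚ 441 * (t * t * ℕ→ℚ m)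
  middle-count = count-bound (suc m) (middle m t) (t * t * ℕ→ℚ m) (≤-trans (ℕ→ℚ-nonNeg 400) 400≤t²m)
                             400≤t²m (middle-width m t)

  4^a*4^m≡[2^n]² : ℕ→ℚ (4 ^ a) * ℕ→ℚ (4 ^ m) ≡ ℕ→ℚ (2 ^ n) * ℕ→ℚ (2 ^ n)
  4^a*4^m≡[2^n]² = begin-equality
    ℕ→ℚ (4 ^ a) * ℕ→ℚ (4 ^ m)      ≡⟨ ℕ→ℚ-* (4 ^ a) (4 ^ m) ⟨
    ℕ→ℚ (4 ^ a ℕ.* 4 ^ m)          ≡⟨ cong ℕ→ℚ (ℕ.^-distribˡ-+-* 4 a m) ⟨
    ℕ→ℚ (4 ^ (a ℕ.+ m))            ≡⟨ cong (λ k → ℕ→ℚ (4 ^ k)) (ℕ.m+[n∸m]≡n a≤n) ⟩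
    ℕ→ℚ (4 ^ n)                    ≡⟨ cong ℕ→ℚ (4^n≡2^n*2^n n) ⟩
    ℕ→ℚ (2 ^ n ℕ.* 2 ^ n)          ≡⟨ ℕ→ℚ-* (2 ^ n) (2 ^ n) ⟩
    ℕ→ℚ (2 ^ n) * ℕ→ℚ (2 ^ n)      ∎
    where open ≤-Reasoning

  disagreement-bound : ∀ {k L} (T : Fin L → Fin k → Fin n) (b : Fin L → Bool) →
    ℕ→ℚ (disagree (fYes c₁ ε A T b) (gYes ε A T b)) ≤ tenth * c₁ * ε * ℕ→ℚ (2 ^ n)
  disagreement-bound T b = begin
    ℕ→ℚ (disagree (fYes c₁ ε A T b) (gYes ε A T b))
      ≤⟨ ℕ→ℚ-mono-≤ {disagree (fYes c₁ ε A T b) (gYes ε A T b)} {Ma ℕ.* cA ℕ.* (Mm ℕ.* cC)} dis≤ ⟩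
    ℕ→ℚ (Ma ℕ.* cA ℕ.* (Mm ℕ.* cC))
      ≡⟨ trans (ℕ→ℚ-* (Ma ℕ.* cA) (Mm ℕ.* cC)) (cong₂ _*_ (ℕ→ℚ-* Ma cA) (ℕ→ℚ-* Mm cC)) ⟩
    ℕ→ℚ Ma * ℕ→ℚ cA * (ℕ→ℚ Mm * ℕ→ℚ cC)
      ≤⟨ final-estimate {Pa = ℕ→ℚ (4 ^ a)} {Pm = ℕ→ℚ (4 ^ m)}
                        (ℕ→ℚ-nonNeg Ma) (ℕ→ℚ-nonNeg Mm) 0<a 0<m (<⇒≤ 0<c₁) (<⇒≤ 0<ε) (ℕ→ℚ-nonNeg (2 ^ n))
                        Ma-bound Mm-bound 4^a*4^m≡[2^n]² central-count middle-count ⟩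
    tenth * c₁ * ε * ℕ→ℚ (2 ^ n)
      ∎
    where
    open ≤-Reasoning
    dis≤ : disagree (fYes c₁ ε A T b) (gYes ε A T b) ℕ.≤ Ma ℕ.* cA ℕ.* (Mm ℕ.* cC)
    dis≤ = ℕ.≤-trans (disagree≤weightCounts c₁ ε A T b)
                     (ℕ.*-mono-≤ (weightCount-≤ a (central c₁ a) (proj₁ (proj₂ (C-max-bound a))))
                                 (weightCount-≤ m (middle m t) (proj₁ (proj₂ (C-max-bound m)))))

-- Every c₁ > 0 works, so c₁max = 1 is arbitrary.
lemma4p1 :
    Σ ℚ λ c₁max → 0ℚ < c₁max ×
      ((c₁ : ℚ) → 0ℚ < c₁ → c₁ ≤ c₁max →
        Σ ℚ λ c₀ → 0ℚ < c₀ ×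
          ((n : ℕ) (ε : ℚ) → 0ℚ < ε → ε < 1ℚ →
            c₀ * c₀ ≤ ε * ε * ℕ→ℚ n →
            (a : ℕ) → IsFloorSqrtDiv n ε a →
            (k : ℕ) → IsFloorSqrtDiv (n ∸ a) ε k →
            (A : Subset n) → ∣ A ∣ ≡ a →
            (T : Fin ((2 ^ k) / 10) → Fin k → Fin n) →
            (∀ ℓ j → T ℓ j ∈ ∁ A) →
            (b : Fin ((2 ^ k) / 10) → Bool) →
            CloseToMonotone (fYes c₁ ε A T b) (tenth * c₁ * ε)))
lemma4p1 = 1ℚ , positive⁻¹ 1ℚ , λ c₁ 0<c₁ _ → c₀ c₁ 0<c₁ , 0<c₀ c₁ 0<c₁ ,
  λ n ε 0<ε ε<1 c₀²≤ε²n a floor _ _ A ∣A∣≡a T _ b →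
    gYes ε A T b , gYes-monotone ε A T b ,
    disagreement-bound c₁ 0<c₁ 0<ε ε<1 c₀²≤ε²n A (subst (IsFloorSqrtDiv n ε) (sym ∣A∣≡a) floor) T b
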